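{- Let $n$ be an odd natural number and let $\mathcal{P}$ be a non-self-dual chiral $n$-polytope with simple Petrie polygons. Then $\mathcal{O}(\mathcal{P})$ (defined below) is an alternating semiregular polyhedron with trivial facet stabilizer, and its symmetry type graph is isomorphic to the premaniplex $\mathcal{A}_n$ described below.
   Context: Graphs may have semi-edges and parallel edges. An $n$-premaniplex is a connected graph with edges colored by $\{0,\dots,n-1\}$, each vertex (flag) incident to exactly one edge of each color, and alternating paths of length 4 in colors $i,j$ closed for $|i-j|>1$; an $n$-maniplex is a simple $n$-premaniplex. $r_i\Phi$ is the flag joined to $\Phi$ by its color-$i$ edge. The $i$-faces are the components after deleting the color-$i$ edges (vertices, edges, facets for $i=0,1,n-1$). Automorphisms are color-preserving graph automorphisms. An abstract $n$-polytope is an $n$-maniplex such that whenever two flags are joined by a path with colors in $[0,m]$ and by one with colors in $[k,n-1]$, they are joined by a path with colors in $[k,m]$; a polyhedron is a 3-polytope. Chiral: exactly two flag orbits under automorphisms, adjacent flags in different orbits. Self-dual: isomorphic to the maniplex obtained by recoloring $i\mapsto n-1-i$. A Petrie polygon is an orbit of flags under $r_{n-1}\cdots r_1r_0$; simple if distinct flags in it lie in distinct vertices. Let $\mathcal{Y}_n$ be the family-1 premaniplex: an $n$-gon (2-premaniplex with $2n$ flags in a cycle alternating colors 0,1) with chosen flag $y_0$ and 1-faces $e_i=\{(r_1r_0)^iy_0,\ r_0(r_1r_0)^iy_0\}$, $0\le i\le n-1$, with an added edge of color 2 joining the two flags of each $e_i$. The operation $\mathcal{O}$: for an $n$-premaniplex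 $\mathcal{P}$, $\mathcal{O}(\mathcal{P})$ is the 3-premaniplex with flag set $\{(\Psi,y)\}$, $\Psi$ a flag of $\mathcal{P}$ and $y$ a flag of $\mathcal{Y}_n$, with $r_0(\Psi,y)=(\Psi,r_0y)$, $r_1(\Psi,y)=(\Psi,r_1y)$, and $r_2(\Psi,y)=(r_j\Psi,r_0y)$ where $e_j$ is the 1-face of $\mathcal{Y}_n$ containing $y$. The premaniplex $\mathcal{A}_n$: two $n$-gons with chosen flags $a$ (outer) and $b$ (inner), with edges of color 2 joining $(r_1r_0)^ia$ with $r_0(r_1r_0)^ib$ and $r_0(r_1r_0)^ia$ with $(r_1r_0)^ib$ for each $0\le i\le n-1$. The symmetry type graph of a maniplex has its flag orbits as vertices with an edge of color $i$ between the orbits of $\Phi$ and $r_i\Phi$ (semi-edge if equal). A polyhedron is semiregular if its automorphism group is transitive on vertices (facets being polygons, hence regular); it is alternating semiregular if moreover it has exactly two orbits of facets and any two flags joined by an edge of color 2 lie in facets of different orbits. Trivial facet stabilizer: only the identity automorphism maps a facet to itself. -}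

module Defs where

open import Data.Nat using (ℕ; zero; suc; _+_; _*_; _≤_; _<_)
open import Data.Nat.DivMod using (_%_; m%n<n)
open import Data.Fin using (Fin; zero; suc; toℕ; fromℕ<; opposite)
open import Data.Unit using (⊤)
open import Data.Bool using (Bool; true; false; not)
open import Data.List using (List; []; _∷_; foldr; foldl; allFin)
open import Data.List.Relation.Unary.All using (All)
open import Data.Product using (Σ; ∃; _×_; _,_)
open import Data.Sum using (_⊎_)
open import Relation.Nullary using (¬_)
open import Relation.Binary.PropositionalEquality using (_≡_; _≢_)
open import Function.Bundles using (_⇔_)

-- Edge-coloured graphs with one edge of each colour at every flag.
-- r i Φ is the flag joined to Φ by its colour-i edge (r i Φ ≡ Φ is a
-- semi-edge; r i Φ ≡ r j Φ with i ≠ j gives parallel edges).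

record FlagGraph (n : ℕ) : Set₁ where
  field
    Flag : Set
    r    : Fin n → Flag → Flag
open FlagGraph public

module _ {n : ℕ} (P : FlagGraph n) where

  walk : List (Fin n) → Flag P → Flag P
  walk w Φ = foldr (r P) Φ w

  PathIn : (Fin n → Set) → Flag P → Flag P → Set
  PathIn S Φ Ψ = Σ (List (Fin n)) λ w → All S w × walk w Φ ≡ Ψ

  Connected : Set
  Connected = ∀ Φ Ψ → PathIn (λ _ → ⊤) Φ Ψ

Far : {n : ℕ} → Fin n → Fin n → Set
Far i j = suc (toℕ i) < toℕ j ⊎ suc (toℕ j) < toℕ i

InRange : {n : ℕ} → ℕ → ℕ → Fin n → Set
InRange a b i = a ≤ toℕ i × toℕ i ≤ b

module _ {n : ℕ} (P : FlagGraph n) where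

  IsPremaniplex : Set
  IsPremaniplex =
      (∀ i Φ → r P i (r P i Φ) ≡ Φ)
    × (∀ i j → Far i j → ∀ Φ → r P i (r P j (r P i (r P j Φ))) ≡ Φ)
    × Connected P

  IsManiplex : Set
  IsManiplex =
      IsPremaniplex
    × (∀ i Φ → r P i Φ ≢ Φ)
    × (∀ i j Φ → i ≢ j → r P i Φ ≢ r P j Φ)

  IsPolytope : Set
  IsPolytope =
      IsManiplex
    × (∀ (k m : ℕ) Φ Ψ → PathIn P (InRange 0 m) Φ Ψ
                        → PathIn P (InRange k (n Data.Nat.∸ 1)) Φ Ψ
                        → PathIn P (InRange k m) Φ Ψ)

  record Automorphism : Set where
    field
      to    : Flag P → Flag P
      from  : Flag P → Flag P
      from∘to : ∀ Φ → from (to Φ) ≡ Φ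
      to∘from : ∀ Φ → to (from Φ) ≡ Φ
      comm  : ∀ i Φ → to (r P i Φ) ≡ r P i (to Φ)

  SameOrbit : Flag P → Flag P → Set
  SameOrbit Φ Ψ = Σ Automorphism λ α → Automorphism.to α Φ ≡ Ψ

  IsChiral : Set
  IsChiral =
      (Σ (Flag P) λ Φ₀ → Σ (Flag P) λ Φ₁ →
          ¬ SameOrbit Φ₀ Φ₁ × (∀ Ψ → SameOrbit Φ₀ Ψ ⊎ SameOrbit Φ₁ Ψ))
    × (∀ i Φ → ¬ SameOrbit Φ (r P i Φ))

  -- isomorphism from P to its dual (recolouring i ↦ n-1-i)
  record DualityIso : Set where
    field
      to    : Flag P → Flag P
      from  : Flag P → Flag P
      from∘to : ∀ Φ → from (to Φ) ≡ Φ
      to∘from : ∀ Φ → to (from Φ) ≡ Φ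
      comm  : ∀ i Φ → to (r P i Φ) ≡ r P (opposite i) (to Φ)

  SelfDual : Set
  SelfDual = DualityIso

  -- i-faces: components after deleting colour-i edges
  SameFace : Fin n → Flag P → Flag P → Set
  SameFace i = PathIn P (λ j → j ≢ i)

  petrie : Flag P → Flag P
  petrie Φ = foldl (λ Ψ i → r P i Ψ) Φ (allFin n)

  petrieIter : ℕ → Flag P → Flag P
  petrieIter zero    Φ = Φ
  petrieIter (suc k) Φ = petrie (petrieIter k Φ)

  -- distinct flags of a Petrie polygon lie in distinct vertices (0-faces)
  SimplePetriePolygons : Set
  SimplePetriePolygons = ∀ Φ (k l : ℕ) →
    PathIn P (λ j → 0 < toℕ j) (petrieIter k Φ) (petrieIter l Φ) →
    petrieIter k Φ ≡ petrieIter l Φ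

module _ (P : FlagGraph 3) where

  SameVertex : Flag P → Flag P → Set
  SameVertex = SameFace P zero

  SameFacet : Flag P → Flag P → Set
  SameFacet = SameFace P (suc (suc zero))

  SameFacetOrbit : Flag P → Flag P → Set
  SameFacetOrbit Φ Ψ = Σ (Automorphism P) λ α → SameFacet (Automorphism.to α Φ) Ψ

  IsSemiregular : Set
  IsSemiregular = IsPolytope P
    × (∀ Φ Ψ → Σ (Automorphism P) λ α → SameVertex (Automorphism.to α Φ) Ψ)

  IsAlternatingSemiregular : Set
  IsAlternatingSemiregular = IsSemiregular
    × (Σ (Flag P) λ Φ₀ → Σ (Flag P) λ Φ₁ →
          ¬ SameFacetOrbit Φ₀ Φ₁ × (∀ Ψ → SameFacetOrbit Φ₀ Ψ ⊎ SameFacetOrbit Φ₁ Ψ))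
    × (∀ Φ → ¬ SameFacetOrbit Φ (r P (suc (suc zero)) Φ))

  TrivialFacetStabilizer : Set
  TrivialFacetStabilizer = ∀ (α : Automorphism P) Φ →
    SameFacet (Automorphism.to α Φ) Φ → ∀ Ψ → Automorphism.to α Ψ ≡ Ψ

-- Symmetry type graph of Q is isomorphic to the flag graph G:
-- a bijection (orbits of Q) ≅ (flags of G) commuting with every r i.

SymmetryTypeGraphIso : {n : ℕ} → FlagGraph n → FlagGraph n → Set
SymmetryTypeGraphIso Q G =
  Σ (Flag Q → Flag G) λ φ →
      (∀ Φ Ψ → (φ Φ ≡ φ Ψ) ⇔ SameOrbit Q Φ Ψ)
    × (∀ x → Σ (Flag Q) λ Φ → φ Φ ≡ x)
    × (∀ i Φ → φ (r Q i Φ) ≡ r G i (φ Φ))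

-- The n-gon: flag (i , false) = (r₁r₀)^i y₀ , (i , true) = r₀(r₁r₀)^i y₀

sucMod : {n : ℕ} → Fin n → Fin n
sucMod {suc m} i = fromℕ< (m%n<n (suc (toℕ i)) (suc m))

predMod : {n : ℕ} → Fin n → Fin n
predMod {suc m} i = fromℕ< (m%n<n (toℕ i + m) (suc m))

polyR0 : {n : ℕ} → Fin n × Bool → Fin n × Bool
polyR0 (i , b) = i , not b

polyR1 : {n : ℕ} → Fin n × Bool → Fin n × Bool
polyR1 (i , false) = predMod i , true
polyR1 (i , true)  = sucMod i , false

Polygon : ℕ → FlagGraph 2
Polygon n = record { Flag = Fin n × Bool ; r = R }
  where
  R : Fin 2 → Fin n × Bool → Fin n × Bool
  R zero    = polyR0
  R (suc _) = polyR1

-- 𝒴_n : the n-gon plus a colour-2 edge joining the two flags of each e_i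
Yn : ℕ → FlagGraph 3
Yn n = record { Flag = Fin n × Bool ; r = R }
  where
  R : Fin 3 → Fin n × Bool → Fin n × Bool
  R zero             = polyR0
  R (suc zero)       = polyR1
  R (suc (suc zero)) = polyR0

-- index j of the 1-face e_j of 𝒴_n containing y
edgeIndex : {n : ℕ} → Flag (Yn n) → Fin n
edgeIndex (i , _) = i

𝒪 : {n : ℕ} → FlagGraph n → FlagGraph 3
𝒪 {n} P = record { Flag = Flag P × Flag (Yn n) ; r = R }
  where
  R : Fin 3 → Flag P × Flag (Yn n) → Flag P × Flag (Yn n)
  R zero             (Ψ , y) = Ψ , r (Yn n) zero y
  R (suc zero)       (Ψ , y) = Ψ , r (Yn n) (suc zero) y
  R (suc (suc zero)) (Ψ , y) = r P (edgeIndex y) Ψ , r (Yn n) zero y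

-- 𝒜_n : outer (true) and inner (false) n-gons; colour 2 joins
-- (r₁r₀)^i a with r₀(r₁r₀)^i b and r₀(r₁r₀)^i a with (r₁r₀)^i b
𝒜 : ℕ → FlagGraph 3
𝒜 n = record { Flag = Bool × (Fin n × Bool) ; r = R }
  where
  R : Fin 3 → Bool × (Fin n × Bool) → Bool × (Fin n × Bool)
  R zero             (s , y)     = s , polyR0 y
  R (suc zero)       (s , y)     = s , polyR1 y
  R (suc (suc zero)) (s , i , c) = not s , i , not c

Odd : ℕ → Set
Odd n = ∃ λ k → n ≡ suc (2 * k)

-- A flag (Ψ , y) of 𝒪 P is a flag Ψ of P together with a flag y of the n-gon; the facets of 𝒪 P
-- are the copies {Ψ} × 𝒴ₙ, and colour 2 applies to Ψ the reflection indexed by the edge of y.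
-- Going around a vertex of 𝒪 P traces a Petrie polygon of P, so simple Petrie polygons and the
-- intersection property of P make 𝒪 P a polytope.  An automorphism of 𝒪 P acts as
-- (Ψ , y) ↦ (f Ψ , δ y) with δ a symmetry of the n-gon and f an isomorphism from P to P recoloured
-- by the permutation σ of colours that δ induces.  Unless δ is trivial, σ either sends the commuting
-- pair r₀, rₙ₋₁ to two adjacent reflections, which never commute in a chiral polytope, or is
-- i ↦ n-1-i, making P self-dual.  Hence Aut(𝒪 P) is Aut(P) acting on the first coordinate, and
-- everything is read off from the two flag orbits of P: the orbit of (Ψ , y) is that of Ψ together
-- with y, the facet orbit is that of Ψ, and since n is odd every vertex meets both orbits.

module Submission where

open import Defs
open import Data.Bool using (Bool; true; false; not; _≟_)
open import Data.Bool.Properties using (not-involutive; not-¬)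
open import Data.Empty using (⊥-elim)
open import Data.Fin using (Fin; zero; suc; toℕ; fromℕ; fromℕ<; opposite)
open import Data.Fin.Properties
  using (toℕ-injective; toℕ<n; toℕ-fromℕ; toℕ-fromℕ<; fromℕ<-toℕ; opposite-prop)
open import Data.List using (List; []; _∷_; _++_; [_]; reverse; foldl; drop; tabulate; allFin)
open import Data.List.Properties
  using (foldr-++; unfold-reverse; reverse-foldr; drop-all; length-tabulate)
open import Data.List.Relation.Unary.All using (All; []; _∷_)
import Data.List.Relation.Unary.All as All
open import Data.List.Relation.Unary.All.Properties using (++⁺; ∷ʳ⁺)
open import Data.Nat using (ℕ; zero; suc; _+_; _*_; _∸_; _≤_; _<_; z≤n; s≤s)
open import Data.Nat.DivMod using (_%_; m%n<n; m<n⇒m%n≡m; [m+n]%n≡m%n; n%n≡0)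
open import Data.Nat.GeneralisedArithmetic using (iterate)
open import Data.Nat.Properties
  using (≤-refl; ≤-reflexive; ≤-trans; ≤-antisym; ≤-total; ≤-pred; <-trans; <-irrefl; <-≤-trans; <-cmp; <⇒≤; <⇒≢;
         ≤⇒≯; ≮⇒≥; ≰⇒>; 1+n≰n; 1+n≢n; n<1+n; m<n+m; m≤n⇒m<n∨m≡n; _≤?_; _<?_;
         +-comm; +-suc; +-∸-assoc; m∸n+n≡m; m+[n∸m]≡n; *-suc; *-monoʳ-≤)
open import Data.Product using (Σ; _×_; _,_; proj₁; proj₂)
open import Data.Sum using (_⊎_; inj₁; inj₂)
open import Data.Unit using (⊤; tt)
open import Function.Base using (_∘_)
open import Function.Bundles using (mk⇔)
open import Relation.Binary.Definitions using (tri<; tri≈; tri>)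
open import Relation.Binary.PropositionalEquality hiding ([_])
open import Relation.Nullary using (¬_)
open import Relation.Nullary.Decidable using (yes; no)

open Automorphism

all-reverse : ∀ {A : Set} {S : A → Set} {xs : List A} → All S xs → All S (reverse xs)
all-reverse {xs = []} [] = []
all-reverse {S = S} {xs = x ∷ xs} (p ∷ ps) =
  subst (All S) (sym (unfold-reverse x xs)) (∷ʳ⁺ (all-reverse ps) p)

drop-tabulate : ∀ {A : Set} {k} (f : Fin k → A) a (a<k : a < k) →
                drop a (tabulate f) ≡ f (fromℕ< a<k) ∷ drop (suc a) (tabulate f)
drop-tabulate {k = suc k} f zero    _         = refl
drop-tabulate {k = suc k} f (suc a) (s≤s a<k) = drop-tabulate (f ∘ suc) a a<k

≢⇒≡not : ∀ {x y : Bool} → x ≢ y → x ≡ not y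
≢⇒≡not {false} {false} x≢y = ⊥-elim (x≢y refl)
≢⇒≡not {false} {true}  _   = refl
≢⇒≡not {true}  {false} _   = refl
≢⇒≡not {true}  {true}  x≢y = ⊥-elim (x≢y refl)

iterate-not-even : ∀ k b → iterate not b (2 * k) ≡ b
iterate-not-even zero    b = refl
iterate-not-even (suc k) b = begin
  iterate not b (2 * suc k)        ≡⟨ cong (iterate not b) (*-suc 2 k) ⟩
  iterate not (not (not b)) (2 * k) ≡⟨ cong (λ x → iterate not x (2 * k)) (not-involutive b) ⟩
  iterate not b (2 * k)            ≡⟨ iterate-not-even k b ⟩
  b                                ∎
  where open ≡-Reasoning

commute-of-involutions : ∀ {A : Set} (f g : A → A) → (∀ x → f (f x) ≡ x) → (∀ x → g (g x) ≡ x) →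
                         (∀ x → f (g (f (g x))) ≡ x) → ∀ x → f (g x) ≡ g (f x)
commute-of-involutions f g f-inv g-inv fgfg≡id x = begin
  f (g x)                  ≡⟨ cong (f ∘ g) (f-inv x) ⟨
  f (g (f (f x)))          ≡⟨ cong (f ∘ g ∘ f) (g-inv (f x)) ⟨
  f (g (f (g (g (f x)))))  ≡⟨ fgfg≡id (g (f x)) ⟩
  g (f x)                  ∎
  where open ≡-Reasoning

toℕ≤n∸1 : ∀ {n} (c : Fin n) → toℕ c ≤ n ∸ 1
toℕ≤n∸1 {suc n} c = ≤-pred (toℕ<n c)

module Walks {n : ℕ} (P : FlagGraph n) where

  walk-++ : ∀ u v Φ → walk P (u ++ v) Φ ≡ walk P u (walk P v Φ)
  walk-++ u v Φ = foldr-++ (r P) Φ u v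

  foldl-walk : ∀ w Φ → foldl (λ Ψ i → r P i Ψ) Φ w ≡ walk P (reverse w) Φ
  foldl-walk w Φ = sym (reverse-foldr (r P) Φ w)

  path-refl : ∀ {S Φ} → PathIn P S Φ Φ
  path-refl = [] , [] , refl

  path-≡ : ∀ {S Φ Ψ} → Φ ≡ Ψ → PathIn P S Φ Ψ
  path-≡ refl = path-refl

  path-trans : ∀ {S Φ Ψ Θ} → PathIn P S Φ Ψ → PathIn P S Ψ Θ → PathIn P S Φ Θ
  path-trans {Φ = Φ} (u , su , refl) (v , sv , refl) = v ++ u , ++⁺ sv su , walk-++ v u Φ

  path-map : ∀ {S T : Fin n → Set} {Φ Ψ} → (∀ {c} → S c → T c) → PathIn P S Φ Ψ → PathIn P T Φ Ψ
  path-map f (w , sw , e) = w , All.map f sw , e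

  walk-path : ∀ {S} w → All S w → ∀ Φ → PathIn P S Φ (walk P w Φ)
  walk-path w sw Φ = w , sw , refl

  module _ (r-involutive : ∀ i Φ → r P i (r P i Φ) ≡ Φ) where

    walk-reverse-cancel : ∀ w Φ → walk P (reverse w) (walk P w Φ) ≡ Φ
    walk-reverse-cancel []      Φ = refl
    walk-reverse-cancel (c ∷ w) Φ = begin
      walk P (reverse (c ∷ w)) (r P c (walk P w Φ))  ≡⟨ cong (λ v → walk P v (r P c (walk P w Φ))) (unfold-reverse c w) ⟩
      walk P (reverse w ++ [ c ]) (r P c (walk P w Φ)) ≡⟨ walk-++ (reverse w) [ c ] _ ⟩
      walk P (reverse w) (r P c (r P c (walk P w Φ)))  ≡⟨ cong (walk P (reverse w)) (r-involutive c _) ⟩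
      walk P (reverse w) (walk P w Φ)                  ≡⟨ walk-reverse-cancel w Φ ⟩
      Φ                                                ∎
      where open ≡-Reasoning

    walk-injective : ∀ w {Φ Ψ} → walk P w Φ ≡ walk P w Ψ → Φ ≡ Ψ
    walk-injective w {Φ} {Ψ} e =
      trans (sym (walk-reverse-cancel w Φ)) (trans (cong (walk P (reverse w)) e) (walk-reverse-cancel w Ψ))

    path-sym : ∀ {S Φ Ψ} → PathIn P S Φ Ψ → PathIn P S Ψ Φ
    path-sym {Φ = Φ} (w , sw , refl) = reverse w , all-reverse sw , walk-reverse-cancel w Φ

module Automorphisms {n : ℕ} (P : FlagGraph n) where

  walk-equivariant : (α : Automorphism P) → ∀ w Φ → to α (walk P w Φ) ≡ walk P w (to α Φ)
  walk-equivariant α []      Φ = refl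
  walk-equivariant α (c ∷ w) Φ = trans (comm α c _) (cong (r P c) (walk-equivariant α w Φ))

  path-equivariant : ∀ {S} (α : Automorphism P) {Φ Ψ} → PathIn P S Φ Ψ → PathIn P S (to α Φ) (to α Ψ)
  path-equivariant α {Φ} (w , sw , refl) = w , sw , sym (walk-equivariant α w Φ)

  _⁻¹ᴬ : Automorphism P → Automorphism P
  α ⁻¹ᴬ = record
    { to = from α ; from = to α ; from∘to = to∘from α ; to∘from = from∘to α
    ; comm = λ i Φ → begin
        from α (r P i Φ)                   ≡⟨ cong (from α ∘ r P i) (to∘from α Φ) ⟨
        from α (r P i (to α (from α Φ)))   ≡⟨ cong (from α) (comm α i (from α Φ)) ⟨
        from α (to α (r P i (from α Φ)))   ≡⟨ from∘to α _ ⟩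
        r P i (from α Φ)                   ∎ }
    where open ≡-Reasoning

  _∘ᴬ_ : Automorphism P → Automorphism P → Automorphism P
  β ∘ᴬ α = record
    { to = to β ∘ to α ; from = from α ∘ from β
    ; from∘to = λ Φ → trans (cong (from α) (from∘to β (to α Φ))) (from∘to α Φ)
    ; to∘from = λ Φ → trans (cong (to β) (to∘from α (from β Φ))) (to∘from β Φ)
    ; comm = λ i Φ → trans (cong (to β) (comm α i Φ)) (comm β i _) }

  sameOrbit-sym : ∀ {Φ Ψ} → SameOrbit P Φ Ψ → SameOrbit P Ψ Φ
  sameOrbit-sym {Φ} (α , refl) = α ⁻¹ᴬ , from∘to α Φ

  sameOrbit-trans : ∀ {Φ Ψ Θ} → SameOrbit P Φ Ψ → SameOrbit P Ψ Θ → SameOrbit P Φ Θ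
  sameOrbit-trans (α , refl) (β , refl) = β ∘ᴬ α , refl

  fixing-a-flag⇒identity : Connected P → (α : Automorphism P) → ∀ Φ → to α Φ ≡ Φ → ∀ Ψ → to α Ψ ≡ Ψ
  fixing-a-flag⇒identity connected α Φ αΦ≡Φ Ψ with connected Φ Ψ
  ... | w , _ , refl = trans (walk-equivariant α w Φ) (cong (walk P w) αΦ≡Φ)

IntersectionProperty : {n : ℕ} → FlagGraph n → Set
IntersectionProperty {n} P = ∀ (k m : ℕ) Φ Ψ →
  PathIn P (InRange 0 m) Φ Ψ → PathIn P (InRange k (n ∸ 1)) Φ Ψ → PathIn P (InRange k m) Φ Ψ

module _ {n : ℕ} (P : FlagGraph n) (r-involutive : ∀ i Φ → r P i (r P i Φ) ≡ Φ)
         (intersection : IntersectionProperty P) where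
  open Walks P

  -- The intersection property for the empty colour interval [a+1, a].
  lower-upper-path : ∀ (a : Fin n) {Φ Ψ} →
    PathIn P (λ c → toℕ c ≤ toℕ a) Φ Ψ → PathIn P (λ c → toℕ a < toℕ c) Φ Ψ → Φ ≡ Ψ
  lower-upper-path a {Φ} {Ψ} lower upper
    with intersection (suc (toℕ a)) (toℕ a) Φ Ψ
           (path-map (z≤n ,_) lower) (path-map (λ {c} a<c → a<c , toℕ≤n∸1 c) upper)
  ... | []    , []                 , Φ≡Ψ = Φ≡Ψ
  ... | _ ∷ _ , (a<c , c≤a) ∷ _ , _   = ⊥-elim (<-irrefl refl (<-≤-trans a<c c≤a))

  higher-colours-cannot-undo : (∀ i Φ → r P i Φ ≢ Φ) →
    ∀ (a : Fin n) w → All (λ c → toℕ a < toℕ c) w → ∀ Θ → walk P w (r P a Θ) ≢ Θ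
  higher-colours-cannot-undo noSemiEdge a w w>a Θ e =
    noSemiEdge a Θ (lower-upper-path a ((a ∷ []) , ≤-refl ∷ [] , r-involutive a Θ) (w , w>a , e))

record Recolouring {n : ℕ} (P : FlagGraph n) (σ : Fin n → Fin n) : Set where
  field
    to      : Flag P → Flag P
    from    : Flag P → Flag P
    from∘to : ∀ Φ → from (to Φ) ≡ Φ
    to∘from : ∀ Φ → to (from Φ) ≡ Φ
    comm    : ∀ i Φ → to (r P i Φ) ≡ r P (σ i) (to Φ)

module _ {n : ℕ} {P : FlagGraph n} {σ : Fin n → Fin n} (ρ : Recolouring P σ) where
  open Recolouring ρ renaming (to to ρ-to; from to ρ-from; from∘to to ρ-from∘to; to∘from to ρ-to∘from; comm to ρ-comm)

  recolouring-automorphism : (∀ i → σ i ≡ i) → Automorphism P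
  recolouring-automorphism σ≡id = record
    { to = ρ-to ; from = ρ-from ; from∘to = ρ-from∘to ; to∘from = ρ-to∘from
    ; comm = λ i Φ → trans (ρ-comm i Φ) (cong (λ j → r P j (ρ-to Φ)) (σ≡id i)) }

  recolouring-duality : (∀ i → σ i ≡ opposite i) → DualityIso P
  recolouring-duality σ≡opposite = record
    { to = ρ-to ; from = ρ-from ; from∘to = ρ-from∘to ; to∘from = ρ-to∘from
    ; comm = λ i Φ → trans (ρ-comm i Φ) (cong (λ j → r P j (ρ-to Φ)) (σ≡opposite i)) }

  recolouring-commute : ∀ i j → (∀ X → r P i (r P j X) ≡ r P j (r P i X)) →
                        ∀ Y → r P (σ i) (r P (σ j) Y) ≡ r P (σ j) (r P (σ i) Y)
  recolouring-commute i j ij-commute Y = begin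
    r P (σ i) (r P (σ j) Y)                   ≡⟨ cong (r P (σ i) ∘ r P (σ j)) (ρ-to∘from Y) ⟨
    r P (σ i) (r P (σ j) (ρ-to X))            ≡⟨ cong (r P (σ i)) (ρ-comm j X) ⟨
    r P (σ i) (ρ-to (r P j X))                ≡⟨ ρ-comm i (r P j X) ⟨
    ρ-to (r P i (r P j X))                    ≡⟨ cong ρ-to (ij-commute X) ⟩
    ρ-to (r P j (r P i X))                    ≡⟨ ρ-comm j (r P i X) ⟩
    r P (σ j) (ρ-to (r P i X))                ≡⟨ cong (r P (σ j)) (ρ-comm i X) ⟩
    r P (σ j) (r P (σ i) (ρ-to X))            ≡⟨ cong (r P (σ j) ∘ r P (σ i)) (ρ-to∘from Y) ⟩
    r P (σ j) (r P (σ i) Y)                   ∎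
    where
    open ≡-Reasoning
    X : Flag P
    X = ρ-from Y

-- Petrie polygons

module PetriePolygons {n : ℕ} (P : FlagGraph n) where

  -- A common iterate avoids the inverse of the Petrie map.
  SamePetriePolygon : Flag P → Flag P → Set
  SamePetriePolygon Φ Ψ = Σ ℕ λ k → Σ ℕ λ l → petrieIter P k Φ ≡ petrieIter P l Ψ

  petrieIter-+ : ∀ k l Φ → petrieIter P (k + l) Φ ≡ petrieIter P k (petrieIter P l Φ)
  petrieIter-+ zero    l Φ = refl
  petrieIter-+ (suc k) l Φ = cong (petrie P) (petrieIter-+ k l Φ)

  samePetrie-≡ : ∀ {Φ Ψ} → Φ ≡ Ψ → SamePetriePolygon Φ Ψ
  samePetrie-≡ Φ≡Ψ = 0 , 0 , Φ≡Ψ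

  samePetrie-sym : ∀ {Φ Ψ} → SamePetriePolygon Φ Ψ → SamePetriePolygon Ψ Φ
  samePetrie-sym (k , l , e) = l , k , sym e

  samePetrie-trans : ∀ {Φ Ψ Θ} → SamePetriePolygon Φ Ψ → SamePetriePolygon Ψ Θ → SamePetriePolygon Φ Θ
  samePetrie-trans {Φ} {Ψ} {Θ} (k , l , e) (k′ , l′ , e′) = k′ + k , l + l′ , (begin
    petrieIter P (k′ + k) Φ                   ≡⟨ petrieIter-+ k′ k Φ ⟩
    petrieIter P k′ (petrieIter P k Φ)        ≡⟨ cong (petrieIter P k′) e ⟩
    petrieIter P k′ (petrieIter P l Ψ)        ≡⟨ petrieIter-+ k′ l Ψ ⟨
    petrieIter P (k′ + l) Ψ                   ≡⟨ cong (λ j → petrieIter P j Ψ) (+-comm k′ l) ⟩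
    petrieIter P (l + k′) Ψ                   ≡⟨ petrieIter-+ l k′ Ψ ⟩
    petrieIter P l (petrieIter P k′ Ψ)        ≡⟨ cong (petrieIter P l) e′ ⟩
    petrieIter P l (petrieIter P l′ Θ)        ≡⟨ petrieIter-+ l l′ Θ ⟨
    petrieIter P (l + l′) Θ                   ∎)
    where open ≡-Reasoning

  module _ (r-involutive : ∀ i Φ → r P i (r P i Φ) ≡ Φ) (simple : SimplePetriePolygons P) where
    open Walks P

    petrie-injective : ∀ {Φ Ψ} → petrie P Φ ≡ petrie P Ψ → Φ ≡ Ψ
    petrie-injective {Φ} {Ψ} e = walk-injective r-involutive (reverse (allFin n))
      (trans (sym (foldl-walk (allFin n) Φ)) (trans e (foldl-walk (allFin n) Ψ)))

    petrieIter-injective : ∀ k {Φ Ψ} → petrieIter P k Φ ≡ petrieIter P k Ψ → Φ ≡ Ψ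
    petrieIter-injective zero    e = e
    petrieIter-injective (suc k) e = petrieIter-injective k (petrie-injective e)

    private
      iterate-in-vertex : ∀ d {Φ Ψ} → Φ ≡ petrieIter P d Ψ → PathIn P (λ c → 0 < toℕ c) Ψ Φ → Ψ ≡ Φ
      iterate-in-vertex d {Ψ = Ψ} refl path = simple Ψ 0 d path

      cancel-common : ∀ k l {Φ Ψ} → k ≤ l → petrieIter P k Φ ≡ petrieIter P l Ψ → Φ ≡ petrieIter P (l ∸ k) Ψ
      cancel-common k l {Φ} {Ψ} k≤l e = petrieIter-injective k (begin
        petrieIter P k Φ                          ≡⟨ e ⟩
        petrieIter P l Ψ                          ≡⟨ cong (λ j → petrieIter P j Ψ) (m+[n∸m]≡n k≤l) ⟨
        petrieIter P (k + (l ∸ k)) Ψ              ≡⟨ petrieIter-+ k (l ∸ k) Ψ ⟩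
        petrieIter P k (petrieIter P (l ∸ k) Ψ)   ∎)
        where open ≡-Reasoning

    samePetrie-sameVertex : ∀ {Φ Ψ} → SamePetriePolygon Φ Ψ → PathIn P (λ c → 0 < toℕ c) Φ Ψ → Φ ≡ Ψ
    samePetrie-sameVertex (k , l , e) path with ≤-total k l
    ... | inj₁ k≤l = sym (iterate-in-vertex (l ∸ k) (cancel-common k l k≤l e) (path-sym r-involutive path))
    ... | inj₂ l≤k = iterate-in-vertex (k ∸ l) (cancel-common l k l≤k (sym e)) path

module PetrieSuffix {m : ℕ} (P : FlagGraph (suc m)) (r-involutive : ∀ i Φ → r P i (r P i Φ) ≡ Φ) where
  open Walks P

  petrieFrom : ℕ → Flag P → Flag P
  petrieFrom a Θ = foldl (λ Ψ i → r P i Ψ) Θ (drop a (allFin (suc m)))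

  petrieFrom-all : ∀ Θ → petrieFrom (suc m) Θ ≡ Θ
  petrieFrom-all Θ =
    cong (foldl (λ Ψ i → r P i Ψ) Θ) (drop-all (suc m) (allFin (suc m)) (≤-reflexive (length-tabulate (λ i → i))))

  petrieFrom-suc : ∀ a (a<n : a < suc m) Θ → petrieFrom a Θ ≡ petrieFrom (suc a) (r P (fromℕ< a<n) Θ)
  petrieFrom-suc a a<n Θ = cong (foldl (λ Ψ i → r P i Ψ) Θ) (drop-tabulate (λ i → i) a a<n)

  petrieFrom-step : ∀ (i : Fin (suc m)) Θ → petrieFrom (toℕ i) Θ ≡ petrieFrom (suc (toℕ i)) (r P i Θ)
  petrieFrom-step i Θ =
    trans (petrieFrom-suc (toℕ i) (toℕ<n i) Θ)
          (cong (λ j → petrieFrom (suc (toℕ i)) (r P j Θ)) (fromℕ<-toℕ i (toℕ<n i)))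

  petrieFrom-as-walk : ∀ d a → d + a ≡ suc m →
    Σ (List (Fin (suc m))) λ w → All (λ c → a ≤ toℕ c) w × (∀ Θ → petrieFrom a Θ ≡ walk P w Θ)
  petrieFrom-as-walk zero    a refl = [] , [] , petrieFrom-all
  petrieFrom-as-walk (suc d) a d+a≡n with petrieFrom-as-walk d (suc a) (trans (+-suc d a) d+a≡n)
  ... | w , w>a , petrieFrom≡walk = w ++ [ i ] , ++⁺ (All.map <⇒≤ w>a) (a≤i ∷ []) , λ Θ → begin
    petrieFrom a Θ                 ≡⟨ petrieFrom-suc a a<n Θ ⟩
    petrieFrom (suc a) (r P i Θ)   ≡⟨ petrieFrom≡walk (r P i Θ) ⟩
    walk P w (r P i Θ)             ≡⟨ walk-++ w [ i ] Θ ⟨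
    walk P (w ++ [ i ]) Θ          ∎
    where
    open ≡-Reasoning
    a<n : a < suc m
    a<n = subst (a <_) d+a≡n (m<n+m a (s≤s z≤n))
    i : Fin (suc m)
    i = fromℕ< a<n
    a≤i : a ≤ toℕ i
    a≤i = ≤-reflexive (sym (toℕ-fromℕ< a<n))

  petrieFrom-path : ∀ a → 1 ≤ a → a ≤ suc m → ∀ Θ → PathIn P (λ c → 0 < toℕ c) Θ (petrieFrom a Θ)
  petrieFrom-path a 1≤a a≤n Θ with petrieFrom-as-walk (suc m ∸ a) a (m∸n+n≡m a≤n)
  ... | w , w≥a , petrieFrom≡walk = w , All.map (≤-trans 1≤a) w≥a , sym (petrieFrom≡walk Θ)

-- Chiral polytopes

module Chirality {n : ℕ} (P : FlagGraph n) (chiral : IsChiral P) where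
  open Automorphisms P

  adjacent-flags-apart : ∀ i Ψ → ¬ SameOrbit P Ψ (r P i Ψ)
  adjacent-flags-apart = proj₂ chiral

  private
    Φ₀ Φ₁ : Flag P
    Φ₀ = proj₁ (proj₁ chiral)
    Φ₁ = proj₁ (proj₂ (proj₁ chiral))

    Φ₀≁Φ₁ : ¬ SameOrbit P Φ₀ Φ₁
    Φ₀≁Φ₁ = proj₁ (proj₂ (proj₂ (proj₁ chiral)))

    two-orbits : ∀ Ψ → SameOrbit P Φ₀ Ψ ⊎ SameOrbit P Φ₁ Ψ
    two-orbits = proj₂ (proj₂ (proj₂ (proj₁ chiral)))

    label : ∀ {Ψ} → SameOrbit P Φ₀ Ψ ⊎ SameOrbit P Φ₁ Ψ → Bool
    label (inj₁ _) = true
    label (inj₂ _) = false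

    label-invariant : ∀ {Ψ Ψ′} (o : _) (o′ : _) → SameOrbit P Ψ Ψ′ → label {Ψ} o ≡ label {Ψ′} o′
    label-invariant (inj₁ _) (inj₁ _) _ = refl
    label-invariant (inj₁ o) (inj₂ o′) Ψ∼Ψ′ =
      ⊥-elim (Φ₀≁Φ₁ (sameOrbit-trans o (sameOrbit-trans Ψ∼Ψ′ (sameOrbit-sym o′))))
    label-invariant (inj₂ o) (inj₁ o′) Ψ∼Ψ′ =
      ⊥-elim (Φ₀≁Φ₁ (sameOrbit-trans o′ (sameOrbit-trans (sameOrbit-sym Ψ∼Ψ′) (sameOrbit-sym o))))
    label-invariant (inj₂ _) (inj₂ _) _ = refl

    label-separates : ∀ {Ψ Ψ′} (o : _) (o′ : _) → label {Ψ} o ≡ label {Ψ′} o′ → SameOrbit P Ψ Ψ′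
    label-separates (inj₁ o) (inj₁ o′) _ = sameOrbit-trans (sameOrbit-sym o) o′
    label-separates (inj₂ o) (inj₂ o′) _ = sameOrbit-trans (sameOrbit-sym o) o′

  orbit : Flag P → Bool
  orbit Ψ = label (two-orbits Ψ)

  sameOrbit⇒orbit≡ : ∀ {Ψ Ψ′} → SameOrbit P Ψ Ψ′ → orbit Ψ ≡ orbit Ψ′
  sameOrbit⇒orbit≡ {Ψ} {Ψ′} = label-invariant (two-orbits Ψ) (two-orbits Ψ′)

  orbit≡⇒sameOrbit : ∀ {Ψ Ψ′} → orbit Ψ ≡ orbit Ψ′ → SameOrbit P Ψ Ψ′
  orbit≡⇒sameOrbit {Ψ} {Ψ′} = label-separates (two-orbits Ψ) (two-orbits Ψ′)

  orbit-r : ∀ i Ψ → orbit (r P i Ψ) ≡ not (orbit Ψ)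
  orbit-r i Ψ = ≢⇒≡not (λ e → adjacent-flags-apart i Ψ (orbit≡⇒sameOrbit (sym e)))

  orbit-surjective : ∀ s → Σ (Flag P) λ Ψ → orbit Ψ ≡ s
  orbit-surjective true  = Φ₀ , label-Φ₀ (two-orbits Φ₀)
    where
    label-Φ₀ : (o : SameOrbit P Φ₀ Φ₀ ⊎ SameOrbit P Φ₁ Φ₀) → label o ≡ true
    label-Φ₀ (inj₁ _) = refl
    label-Φ₀ (inj₂ o) = ⊥-elim (Φ₀≁Φ₁ (sameOrbit-sym o))
  orbit-surjective false = Φ₁ , label-Φ₁ (two-orbits Φ₁)
    where
    label-Φ₁ : (o : SameOrbit P Φ₀ Φ₁ ⊎ SameOrbit P Φ₁ Φ₁) → label o ≡ false
    label-Φ₁ (inj₁ o) = ⊥-elim (Φ₀≁Φ₁ o)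
    label-Φ₁ (inj₂ _) = refl

module _ {n : ℕ} (P : FlagGraph n) (premaniplex : IsPremaniplex P) (intersection : IntersectionProperty P)
         (chiral : IsChiral P) (a b : Fin n) (b≡1+a : toℕ b ≡ suc (toℕ a)) where
  open Walks P
  open Automorphisms P
  open Chirality P chiral

  private
    r-involutive : ∀ i Φ → r P i (r P i Φ) ≡ Φ
    r-involutive = proj₁ premaniplex
    far-commute : ∀ i j → Far i j → ∀ Φ → r P i (r P j (r P i (r P j Φ))) ≡ Φ
    far-commute = proj₁ (proj₂ premaniplex)
    connected : Connected P
    connected = proj₂ (proj₂ premaniplex)

    Lower Upper : Fin n → Set
    Lower c = toℕ c ≤ toℕ a
    Upper c = toℕ a < toℕ c

    base : Flag P
    base = proj₁ (orbit-surjective true)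

  -- If rₐ and r_b commute, every flag is u (v base) with the colours of u at most a and those of v
  -- above a, and g : u (v base) ↦ u (rₐ (v base)) is an automorphism moving base to rₐ base.
  -- It is well defined by the intersection property and an automorphism α₀ sending base to
  -- rₐ (r_b base), which lies in the orbit of base.
  module _ (ab-commute : ∀ X → r P a (r P b X) ≡ r P b (r P a X)) where
    private
      lower-upper-commute : ∀ {c d} → Lower c → Upper d → ∀ X → r P c (r P d X) ≡ r P d (r P c X)
      lower-upper-commute {c} {d} c≤a a<d X with suc (toℕ c) <? toℕ d
      ... | yes c+1<d = commute-of-involutions (r P c) (r P d) (r-involutive c) (r-involutive d)
                          (far-commute c d (inj₁ c+1<d)) X
      ... | no  c+1≮d =
        subst₂ (λ c′ d′ → r P c′ (r P d′ X) ≡ r P d′ (r P c′ X)) (sym c≡a) (sym d≡b) (ab-commute X)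
        where
        d≤1+c : toℕ d ≤ suc (toℕ c)
        d≤1+c = ≮⇒≥ c+1≮d
        c≡a : c ≡ a
        c≡a = toℕ-injective (≤-antisym c≤a (≤-pred (≤-trans a<d d≤1+c)))
        d≡b : d ≡ b
        d≡b = toℕ-injective (trans (≤-antisym (≤-trans d≤1+c (s≤s c≤a)) a<d) (sym b≡1+a))

      lower-past-upper : ∀ {c} → Lower c → ∀ v → All Upper v → ∀ X → r P c (walk P v X) ≡ walk P v (r P c X)
      lower-past-upper c≤a []      []             X = refl
      lower-past-upper c≤a (d ∷ v) (a<d ∷ v>a) X =
        trans (lower-upper-commute c≤a a<d _) (cong (r P d) (lower-past-upper c≤a v v>a X))

      lower-upper-walks-commute : ∀ u → All Lower u → ∀ v → All Upper v → ∀ X →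
                                  walk P u (walk P v X) ≡ walk P v (walk P u X)
      lower-upper-walks-commute []      []             v v>a X = refl
      lower-upper-walks-commute (c ∷ u) (c≤a ∷ u≤a) v v>a X =
        trans (cong (r P c) (lower-upper-walks-commute u u≤a v v>a X)) (lower-past-upper c≤a v v>a _)

      record Split (w : List (Fin n)) : Set where
        field
          lower : List (Fin n)
          upper : List (Fin n)
          all-lower : All Lower lower
          all-upper : All Upper upper
          walk-split : ∀ X → walk P w X ≡ walk P lower (walk P upper X)

      split : ∀ w → Split w
      split []      = record { lower = [] ; upper = [] ; all-lower = [] ; all-upper = [] ; walk-split = λ _ → refl }
      split (c ∷ w) with split w | toℕ c ≤? toℕ a
      ... | s | yes c≤a = record
        { lower = c ∷ lower ; upper = upper ; all-lower = c≤a ∷ all-lower ; all-upper = all-upper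
        ; walk-split = λ X → cong (r P c) (walk-split X) }
        where open Split s
      ... | s | no c≰a = record
        { lower = lower ; upper = c ∷ upper ; all-lower = all-lower ; all-upper = ≰⇒> c≰a ∷ all-upper
        ; walk-split = λ X → trans (cong (r P c) (walk-split X))
                                   (sym (lower-upper-walks-commute lower all-lower [ c ] (≰⇒> c≰a ∷ []) _)) }
        where open Split s

      base∼twice-reflected : SameOrbit P base (r P a (r P b base))
      base∼twice-reflected = orbit≡⇒sameOrbit
        (sym (trans (orbit-r a _) (trans (cong not (orbit-r b base)) (not-involutive _))))

      α₀ : Automorphism P
      α₀ = proj₁ base∼twice-reflected

      lower-walk-from-rₐ : ∀ u → All Lower u → walk P u (r P a base) ≡ r P b (to α₀ (walk P u base))
      lower-walk-from-rₐ u u≤a = sym (begin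
        r P b (to α₀ (walk P u base))            ≡⟨ cong (r P b) (walk-equivariant α₀ u base) ⟩
        r P b (walk P u (to α₀ base))            ≡⟨ cong (r P b ∘ walk P u)
                                                        (trans (proj₂ base∼twice-reflected) (ab-commute base)) ⟩
        r P b (walk P u (r P b (r P a base)))    ≡⟨ cong (r P b) (lower-upper-walks-commute u u≤a [ b ] (a<b ∷ []) _) ⟩
        r P b (r P b (walk P u (r P a base)))    ≡⟨ r-involutive b _ ⟩
        walk P u (r P a base)                    ∎)
        where
        open ≡-Reasoning
        a<b : Upper b
        a<b = ≤-reflexive (sym b≡1+a)

      module _ {u v u′ v′} (u≤a : All Lower u) (v>a : All Upper v) (u′≤a : All Lower u′) (v′>a : All Upper v′)
               (same : walk P u (walk P v base) ≡ walk P u′ (walk P v′ base)) where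

        same-lower-part : walk P u base ≡ walk P u′ base
        same-lower-part = lower-upper-path P r-involutive intersection a
          (path-trans (path-sym r-involutive (walk-path u u≤a base)) (walk-path u′ u′≤a base))
          (path-trans (walk-path v v>a (walk P u base))
            (path-trans (path-≡ upper-ends) (path-sym r-involutive (walk-path v′ v′>a (walk P u′ base)))))
          where
          upper-ends : walk P v (walk P u base) ≡ walk P v′ (walk P u′ base)
          upper-ends = trans (sym (lower-upper-walks-commute u u≤a v v>a base))
                             (trans same (lower-upper-walks-commute u′ u′≤a v′ v′>a base))

        same-upper-part : walk P v base ≡ walk P v′ base
        same-upper-part = walk-injective r-involutive u (begin
          walk P u (walk P v base)    ≡⟨ same ⟩
          walk P u′ (walk P v′ base)  ≡⟨ lower-upper-walks-commute u′ u′≤a v′ v′>a base ⟩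
          walk P v′ (walk P u′ base)  ≡⟨ cong (walk P v′) same-lower-part ⟨
          walk P v′ (walk P u base)   ≡⟨ lower-upper-walks-commute u u≤a v′ v′>a base ⟨
          walk P u (walk P v′ base)   ∎)
          where open ≡-Reasoning

      twisted : ∀ u v → All Lower u → All Upper v →
                walk P u (r P a (walk P v base)) ≡ walk P v (r P b (to α₀ (walk P u base)))
      twisted u v u≤a v>a = begin
        walk P u (r P a (walk P v base))  ≡⟨ cong (walk P u) (lower-past-upper ≤-refl v v>a base) ⟩
        walk P u (walk P v (r P a base))  ≡⟨ lower-upper-walks-commute u u≤a v v>a _ ⟩
        walk P v (walk P u (r P a base))  ≡⟨ cong (walk P v) (lower-walk-from-rₐ u u≤a) ⟩
        walk P v (r P b (to α₀ (walk P u base))) ∎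
        where open ≡-Reasoning

      twisted-well-defined : ∀ {u v u′ v′} → All Lower u → All Upper v → All Lower u′ → All Upper v′ →
        walk P u (walk P v base) ≡ walk P u′ (walk P v′ base) →
        walk P u (r P a (walk P v base)) ≡ walk P u′ (r P a (walk P v′ base))
      twisted-well-defined {u} {v} {u′} {v′} u≤a v>a u′≤a v′>a same = begin
        walk P u (r P a (walk P v base))            ≡⟨ cong (walk P u ∘ r P a)
                                                            (same-upper-part u≤a v>a u′≤a v′>a same) ⟩
        walk P u (r P a (walk P v′ base))           ≡⟨ twisted u v′ u≤a v′>a ⟩
        walk P v′ (r P b (to α₀ (walk P u base)))   ≡⟨ cong (walk P v′ ∘ r P b ∘ to α₀)
                                                            (same-lower-part u≤a v>a u′≤a v′>a same) ⟩
        walk P v′ (r P b (to α₀ (walk P u′ base)))  ≡⟨ twisted u′ v′ u′≤a v′>a ⟨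
        walk P u′ (r P a (walk P v′ base))          ∎
        where open ≡-Reasoning

      g : Flag P → Flag P
      g X = walk P lower (r P a (walk P upper base))
        where open Split (split (proj₁ (connected base X)))

      split-of : ∀ X → X ≡ walk P (Split.lower (split (proj₁ (connected base X))))
                                  (walk P (Split.upper (split (proj₁ (connected base X)))) base)
      split-of X with connected base X
      ... | w , _ , refl = Split.walk-split (split w) base

      g-spec : ∀ u v → All Lower u → All Upper v → ∀ X → X ≡ walk P u (walk P v base) →
               g X ≡ walk P u (r P a (walk P v base))
      g-spec u v u≤a v>a X X≡uv = twisted-well-defined all-lower all-upper u≤a v>a (trans (sym (split-of X)) X≡uv)
        where open Split (split (proj₁ (connected base X)))

      g-comm : ∀ c X → g (r P c X) ≡ r P c (g X)
      g-comm c X with toℕ c ≤? toℕ a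
      ... | yes c≤a = g-spec (c ∷ lower) upper (c≤a ∷ all-lower) all-upper (r P c X) (cong (r P c) (split-of X))
        where open Split (split (proj₁ (connected base X)))
      ... | no  c≰a = begin
        g (r P c X)                                      ≡⟨ g-spec lower (c ∷ upper) all-lower (a<c ∷ all-upper) (r P c X)
                                                              (trans (cong (r P c) (split-of X)) (c-past-lower _)) ⟩
        walk P lower (r P a (r P c (walk P upper base))) ≡⟨ cong (walk P lower) (lower-upper-commute ≤-refl a<c _) ⟩
        walk P lower (r P c (r P a (walk P upper base))) ≡⟨ c-past-lower _ ⟨
        r P c (g X)                                      ∎
        where
        open ≡-Reasoning
        open Split (split (proj₁ (connected base X)))
        a<c : Upper c
        a<c = ≰⇒> c≰a
        c-past-lower : ∀ Y → r P c (walk P lower Y) ≡ walk P lower (r P c Y)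
        c-past-lower Y = sym (lower-upper-walks-commute lower all-lower [ c ] (a<c ∷ []) Y)

      g-involutive : ∀ X → g (g X) ≡ X
      g-involutive X = begin
        g (g X)                                          ≡⟨ g-spec (lower ++ [ a ]) upper (++⁺ all-lower (≤-refl ∷ [])) all-upper
                                                              (g X) (sym (walk-++ lower [ a ] _)) ⟩
        walk P (lower ++ [ a ]) (r P a (walk P upper base)) ≡⟨ walk-++ lower [ a ] _ ⟩
        walk P lower (r P a (r P a (walk P upper base))) ≡⟨ cong (walk P lower) (r-involutive a _) ⟩
        walk P lower (walk P upper base)                 ≡⟨ split-of X ⟨
        X                                                ∎
        where
        open ≡-Reasoning
        open Split (split (proj₁ (connected base X)))

      g-automorphism : Automorphism P
      g-automorphism = record { to = g ; from = g ; from∘to = g-involutive ; to∘from = g-involutive ; comm = g-comm }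

    base∼rₐbase : SameOrbit P base (r P a base)
    base∼rₐbase = g-automorphism , g-spec [] [] [] [] base refl

  adjacent-reflections-noncommuting : ¬ (∀ X → r P a (r P b X) ≡ r P b (r P a X))
  adjacent-reflections-noncommuting ab-commute = adjacent-flags-apart a base (base∼rₐbase ab-commute)

rank-one-not-chiral : (P : FlagGraph 1) → (∀ i Φ → r P i (r P i Φ) ≡ Φ) → ¬ IsChiral P
rank-one-not-chiral P r-involutive chiral = proj₂ chiral zero Φ (r₀ , refl)
  where
  Φ : Flag P
  Φ = proj₁ (proj₁ chiral)
  r₀ : Automorphism P
  r₀ = record { to = r P zero ; from = r P zero ; from∘to = r-involutive zero ; to∘from = r-involutive zero
              ; comm = λ { zero _ → refl } }

-- The polygon 𝒴 and the operation 𝒪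

module Cyclic {m : ℕ} where

  last : Fin (suc m)
  last = fromℕ m

  toℕ-sucMod : (i : Fin (suc m)) → toℕ (sucMod i) ≡ suc (toℕ i) % suc m
  toℕ-sucMod i = toℕ-fromℕ< (m%n<n (suc (toℕ i)) (suc m))

  toℕ-predMod : (i : Fin (suc m)) → toℕ (predMod i) ≡ (toℕ i + m) % suc m
  toℕ-predMod i = toℕ-fromℕ< (m%n<n (toℕ i + m) (suc m))

  toℕ-sucMod-< : (i : Fin (suc m)) → toℕ i < m → toℕ (sucMod i) ≡ suc (toℕ i)
  toℕ-sucMod-< i i<m = trans (toℕ-sucMod i) (m<n⇒m%n≡m (s≤s i<m))

  toℕ-sucMod-≡ : (i : Fin (suc m)) → toℕ i ≡ m → toℕ (sucMod i) ≡ 0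
  toℕ-sucMod-≡ i i≡m = trans (toℕ-sucMod i) (trans (cong (λ x → suc x % suc m) i≡m) (n%n≡0 (suc m)))

  toℕ-predMod-suc : (i : Fin (suc m)) {k : ℕ} → toℕ i ≡ suc k → toℕ (predMod i) ≡ k
  toℕ-predMod-suc i {k} i≡1+k = begin
    toℕ (predMod i)      ≡⟨ toℕ-predMod i ⟩
    (toℕ i + m) % suc m  ≡⟨ cong (λ x → (x + m) % suc m) i≡1+k ⟩
    (suc k + m) % suc m  ≡⟨ cong (_% suc m) (+-suc k m) ⟨
    (k + suc m) % suc m  ≡⟨ [m+n]%n≡m%n k (suc m) ⟩
    k % suc m            ≡⟨ m<n⇒m%n≡m (<-trans (n<1+n k) (subst (_< suc m) i≡1+k (toℕ<n i))) ⟩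
    k                    ∎
    where open ≡-Reasoning

  toℕ-predMod-zero : (i : Fin (suc m)) → toℕ i ≡ 0 → toℕ (predMod i) ≡ m
  toℕ-predMod-zero i i≡0 =
    trans (toℕ-predMod i) (trans (cong (λ x → (x + m) % suc m) i≡0) (m<n⇒m%n≡m ≤-refl))

  predMod-zero : predMod zero ≡ last
  predMod-zero = toℕ-injective (trans (toℕ-predMod-zero zero refl) (sym (toℕ-fromℕ m)))

  predMod-sucMod : (i : Fin (suc m)) → predMod (sucMod i) ≡ i
  predMod-sucMod i with m≤n⇒m<n∨m≡n (≤-pred (toℕ<n i))
  ... | inj₁ i<m = toℕ-injective (toℕ-predMod-suc (sucMod i) (toℕ-sucMod-< i i<m))
  ... | inj₂ i≡m = toℕ-injective (trans (toℕ-predMod-zero (sucMod i) (toℕ-sucMod-≡ i i≡m)) (sym i≡m))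

  sucMod-predMod : (i : Fin (suc m)) → sucMod (predMod i) ≡ i
  sucMod-predMod zero    = toℕ-injective (toℕ-sucMod-≡ (predMod zero) (toℕ-predMod-zero zero refl))
  sucMod-predMod (suc j) = toℕ-injective (begin
    toℕ (sucMod (predMod (suc j)))  ≡⟨ toℕ-sucMod-< (predMod (suc j)) pred<m ⟩
    suc (toℕ (predMod (suc j)))     ≡⟨ cong suc (toℕ-predMod-suc (suc j) refl) ⟩
    suc (toℕ j)                     ∎)
    where
    open ≡-Reasoning
    pred<m : toℕ (predMod (suc j)) < m
    pred<m = subst (_< m) (sym (toℕ-predMod-suc (suc j) refl)) (toℕ<n j)

  predMod-≢ : 1 ≤ m → (i : Fin (suc m)) → predMod i ≢ i
  predMod-≢ 1≤m zero    pred≡i = <⇒≢ 1≤m (sym (trans (sym (toℕ-predMod-zero zero refl)) (cong toℕ pred≡i)))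
  predMod-≢ 1≤m (suc j) pred≡i = 1+n≢n (sym (trans (sym (toℕ-predMod-suc (suc j) refl)) (cong toℕ pred≡i)))

  sucMod-≢ : 1 ≤ m → (i : Fin (suc m)) → sucMod i ≢ i
  sucMod-≢ 1≤m i suc≡i = predMod-≢ 1≤m i (trans (cong predMod (sym suc≡i)) (predMod-sucMod i))

  opposite-zero : opposite (zero {m}) ≡ last
  opposite-zero = toℕ-injective (trans (opposite-prop (zero {m})) (sym (toℕ-fromℕ m)))

  predMod-opposite : (i : Fin (suc m)) → toℕ i < m → predMod (opposite i) ≡ opposite (sucMod i)
  predMod-opposite i i<m = toℕ-injective (begin
    toℕ (predMod (opposite i))      ≡⟨ toℕ-predMod-suc (opposite i) opposite≡1+ ⟩
    m ∸ suc (toℕ i)                 ≡⟨ cong (m ∸_) (toℕ-sucMod-< i i<m) ⟨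
    m ∸ toℕ (sucMod i)              ≡⟨ opposite-prop (sucMod i) ⟨
    toℕ (opposite (sucMod i))       ∎)
    where
    open ≡-Reasoning
    opposite≡1+ : toℕ (opposite i) ≡ suc (m ∸ suc (toℕ i))
    opposite≡1+ = trans (opposite-prop i) (+-∸-assoc 1 i<m)

c₀ c₁ c₂ : Fin 3
c₀ = zero
c₁ = suc zero
c₂ = suc (suc zero)

module Polygon {m : ℕ} where
  open Cyclic {m}

  𝒴 : FlagGraph 3
  𝒴 = Yn (suc m)

  base : Fin (suc m) × Bool
  base = zero , false

  polyR0-involutive : ∀ y → polyR0 {suc m} (polyR0 y) ≡ y
  polyR0-involutive (i , b) = cong (i ,_) (not-involutive b)

  polyR1-involutive : ∀ y → polyR1 {suc m} (polyR1 y) ≡ y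
  polyR1-involutive (i , false) = cong (_, false) (sucMod-predMod i)
  polyR1-involutive (i , true)  = cong (_, true) (predMod-sucMod i)

  𝒴-involutive : ∀ i y → r 𝒴 i (r 𝒴 i y) ≡ y
  𝒴-involutive zero             = polyR0-involutive
  𝒴-involutive (suc zero)       = polyR1-involutive
  𝒴-involutive (suc (suc zero)) = polyR0-involutive

  -- The i-th vertex of the n-gon is its r₁-edge {(i , true) , (i+1 , false)}.
  polygonVertex : Fin (suc m) × Bool → Fin (suc m)
  polygonVertex (i , false) = predMod i
  polygonVertex (i , true)  = i

  polygonVertex-polyR1 : ∀ y → polygonVertex (polyR1 y) ≡ polygonVertex y
  polygonVertex-polyR1 (i , false) = refl
  polygonVertex-polyR1 (i , true)  = predMod-sucMod i

  polygonVertex-≡ : ∀ y y′ → polygonVertex y ≡ polygonVertex y′ → y′ ≡ y ⊎ y′ ≡ polyR1 y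
  polygonVertex-≡ (i , false) (j , false) e =
    inj₁ (cong (_, false) (trans (sym (sucMod-predMod j)) (trans (cong sucMod (sym e)) (sucMod-predMod i))))
  polygonVertex-≡ (i , false) (j , true)  e = inj₂ (cong (_, true) (sym e))
  polygonVertex-≡ (i , true)  (j , false) e = inj₂ (cong (_, false) (trans (sym (sucMod-predMod j)) (cong sucMod (sym e))))
  polygonVertex-≡ (i , true)  (j , true)  e = inj₁ (cong (_, true) (sym e))

  polyR0≢polyR1 : 1 ≤ m → ∀ y → polyR0 y ≢ polyR1 y
  polyR0≢polyR1 1≤m (i , false) e = predMod-≢ 1≤m i (sym (cong proj₁ e))
  polyR0≢polyR1 1≤m (i , true)  e = sucMod-≢ 1≤m i (sym (cong proj₁ e))

  polyR0≢id : ∀ y → polyR0 {suc m} y ≢ y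
  polyR0≢id (i , b) e = not-¬ refl (sym (cong proj₂ e))

  polyR1≢id : ∀ y → polyR1 {suc m} y ≢ y
  polyR1≢id (i , false) ()
  polyR1≢id (i , true)  ()

  rotations : ℕ → List (Fin 3)
  rotations zero    = []
  rotations (suc t) = c₁ ∷ c₀ ∷ rotations t

  polygonWord : Fin (suc m) × Bool → List (Fin 3)
  polygonWord (i , false) = rotations (toℕ i)
  polygonWord (i , true)  = c₀ ∷ rotations (toℕ i)

  polygonWord-avoids-c₂ : ∀ y → All (λ c → c ≢ c₂) (polygonWord y)
  polygonWord-avoids-c₂ (i , false) = rotations-avoid-c₂ (toℕ i)
    where
    rotations-avoid-c₂ : ∀ t → All (λ c → c ≢ c₂) (rotations t)
    rotations-avoid-c₂ zero    = []
    rotations-avoid-c₂ (suc t) = (λ ()) ∷ (λ ()) ∷ rotations-avoid-c₂ t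
  polygonWord-avoids-c₂ (i , true) = (λ ()) ∷ polygonWord-avoids-c₂ (i , false)

  rotations-from-base : ∀ t (i : Fin (suc m)) → toℕ i ≡ t → walk 𝒴 (rotations t) base ≡ (i , false)
  rotations-from-base zero    i i≡0   = cong (_, false) (toℕ-injective (sym i≡0))
  rotations-from-base (suc t) i i≡1+t = begin
    polyR1 (polyR0 (walk 𝒴 (rotations t) base)) ≡⟨ cong (polyR1 ∘ polyR0)
                                                        (rotations-from-base t (predMod i) (toℕ-predMod-suc i i≡1+t)) ⟩
    (sucMod (predMod i) , false)                 ≡⟨ cong (_, false) (sucMod-predMod i) ⟩
    (i , false)                                  ∎
    where open ≡-Reasoning

  rotations-from-last : ∀ t (i : Fin (suc m)) → toℕ i ≡ t → walk 𝒴 (rotations t) (last , true) ≡ (opposite i , true)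
  rotations-from-last zero    i i≡0   = cong (_, true) (trans (sym opposite-zero) (cong opposite (toℕ-injective (sym i≡0))))
  rotations-from-last (suc t) i i≡1+t = begin
    polyR1 (polyR0 (walk 𝒴 (rotations t) (last , true))) ≡⟨ cong (polyR1 ∘ polyR0)
                                                                 (rotations-from-last t (predMod i) pred≡t) ⟩
    (predMod (opposite (predMod i)) , true)               ≡⟨ cong (_, true) (predMod-opposite (predMod i) pred<m) ⟩
    (opposite (sucMod (predMod i)) , true)                ≡⟨ cong (λ j → opposite j , true) (sucMod-predMod i) ⟩
    (opposite i , true)                                   ∎
    where
    open ≡-Reasoning
    pred≡t : toℕ (predMod i) ≡ t
    pred≡t = toℕ-predMod-suc i i≡1+t
    pred<m : toℕ (predMod i) < m
    pred<m = subst (_< m) (sym pred≡t) (≤-pred (subst (_< suc m) i≡1+t (toℕ<n i)))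

  polygonWord-from-base : ∀ y → walk 𝒴 (polygonWord y) base ≡ y
  polygonWord-from-base (i , false) = rotations-from-base (toℕ i) i refl
  polygonWord-from-base (i , true)  = cong polyR0 (rotations-from-base (toℕ i) i refl)

  polygonWord-to-base : ∀ y → walk 𝒴 (reverse (polygonWord y)) y ≡ base
  polygonWord-to-base y = trans (cong (walk 𝒴 (reverse (polygonWord y))) (sym (polygonWord-from-base y)))
                                (Walks.walk-reverse-cancel 𝒴 𝒴-involutive (polygonWord y) base)

  polygonWord-from-last : ∀ j → walk 𝒴 (polygonWord (j , false)) (last , true) ≡ (opposite j , true)
  polygonWord-from-last j = rotations-from-last (toℕ j) j refl

module Operation {m : ℕ} (P : FlagGraph (suc m)) where
  open Polygon {m}
  open Walks (𝒪 P)

  walk-𝒪-avoiding-c₂ : ∀ w → All (λ c → c ≢ c₂) w → ∀ Ψ y → walk (𝒪 P) w (Ψ , y) ≡ (Ψ , walk 𝒴 w y)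
  walk-𝒪-avoiding-c₂ []                   []         Ψ y = refl
  walk-𝒪-avoiding-c₂ (zero ∷ w)           (_ ∷ w≢c₂) Ψ y = cong (r (𝒪 P) c₀) (walk-𝒪-avoiding-c₂ w w≢c₂ Ψ y)
  walk-𝒪-avoiding-c₂ (suc zero ∷ w)       (_ ∷ w≢c₂) Ψ y = cong (r (𝒪 P) c₁) (walk-𝒪-avoiding-c₂ w w≢c₂ Ψ y)
  walk-𝒪-avoiding-c₂ (suc (suc zero) ∷ w) (c≢c₂ ∷ _) Ψ y = ⊥-elim (c≢c₂ refl)

  walk-polygonWord : ∀ Ψ y → walk (𝒪 P) (polygonWord y) (Ψ , base) ≡ (Ψ , y)
  walk-polygonWord Ψ y =
    trans (walk-𝒪-avoiding-c₂ (polygonWord y) (polygonWord-avoids-c₂ y) Ψ base)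
          (cong (Ψ ,_) (polygonWord-from-base y))

  sameFacet-intro : ∀ Ψ y y′ → SameFacet (𝒪 P) (Ψ , y) (Ψ , y′)
  sameFacet-intro Ψ y y′ = w , avoids , (begin
    walk (𝒪 P) w (Ψ , y)
      ≡⟨ walk-𝒪-avoiding-c₂ w avoids Ψ y ⟩
    (Ψ , walk 𝒴 w y)
      ≡⟨ cong (Ψ ,_) (Walks.walk-++ 𝒴 (polygonWord y′) _ y) ⟩
    (Ψ , walk 𝒴 (polygonWord y′) (walk 𝒴 (reverse (polygonWord y)) y))
      ≡⟨ cong (λ x → Ψ , walk 𝒴 (polygonWord y′) x) (polygonWord-to-base y) ⟩
    (Ψ , walk 𝒴 (polygonWord y′) base)
      ≡⟨ cong (Ψ ,_) (polygonWord-from-base y′) ⟩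
    (Ψ , y′)
      ∎)
    where
    open ≡-Reasoning
    w : List (Fin 3)
    w = polygonWord y′ ++ reverse (polygonWord y)
    avoids : All (λ c → c ≢ c₂) w
    avoids = ++⁺ (polygonWord-avoids-c₂ y′) (all-reverse (polygonWord-avoids-c₂ y))

  sameFacet-fst : ∀ {Φ Φ′} → SameFacet (𝒪 P) Φ Φ′ → proj₁ Φ ≡ proj₁ Φ′
  sameFacet-fst {Ψ , y} (w , w≢c₂ , refl) = sym (cong proj₁ (walk-𝒪-avoiding-c₂ w w≢c₂ Ψ y))

  𝒪-connected : Connected P → Connected (𝒪 P)
  𝒪-connected connected (Ψ , y) (Ψ′ , y′) with connected Ψ Ψ′
  ... | w , _ , refl =
    path-trans (anyColour (sameFacet-intro Ψ y base))
               (path-trans (lift-walk w Ψ) (anyColour (sameFacet-intro (walk P w Ψ) base y′)))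
    where
    anyColour : ∀ {Φ Φ′} → SameFacet (𝒪 P) Φ Φ′ → PathIn (𝒪 P) (λ _ → ⊤) Φ Φ′
    anyColour = path-map (λ _ → tt)
    lift-walk : ∀ v X → PathIn (𝒪 P) (λ _ → ⊤) (X , base) (walk P v X , base)
    lift-walk []      X = path-refl
    lift-walk (c ∷ v) X = path-trans (lift-walk v X)
      (path-trans (anyColour (sameFacet-intro _ base (c , false)))
        (path-trans (walk-path (c₀ ∷ c₂ ∷ []) (tt ∷ tt ∷ []) _)
          (anyColour (sameFacet-intro _ (c , false) base))))

  module _ (r-involutive : ∀ i Φ → r P i (r P i Φ) ≡ Φ) where

    𝒪-involutive : ∀ i Φ → r (𝒪 P) i (r (𝒪 P) i Φ) ≡ Φ
    𝒪-involutive zero             (Ψ , y)     = cong (Ψ ,_) (polyR0-involutive y)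
    𝒪-involutive (suc zero)       (Ψ , y)     = cong (Ψ ,_) (polyR1-involutive y)
    𝒪-involutive (suc (suc zero)) (Ψ , k , b) = cong₂ _,_ (r-involutive k Ψ) (cong (k ,_) (not-involutive b))

    private
      r₀r₂r₀r₂≡id : ∀ Ψ k b → (r P k (r P k Ψ) , k , not (not (not (not b)))) ≡ (Ψ , k , b)
      r₀r₂r₀r₂≡id Ψ k b = cong₂ _,_ (r-involutive k Ψ) (cong (k ,_) (trans (not-involutive _) (not-involutive b)))

    𝒪-far : ∀ i j → Far i j → ∀ Φ → r (𝒪 P) i (r (𝒪 P) j (r (𝒪 P) i (r (𝒪 P) j Φ))) ≡ Φ
    𝒪-far zero             (suc (suc zero)) _ (Ψ , k , b) = r₀r₂r₀r₂≡id Ψ k b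
    𝒪-far (suc (suc zero)) zero             _ (Ψ , k , b) = r₀r₂r₀r₂≡id Ψ k b
    𝒪-far zero             zero             _ Φ = trans (𝒪-involutive c₀ _) (𝒪-involutive c₀ Φ)
    𝒪-far (suc zero)       (suc zero)       _ Φ = trans (𝒪-involutive c₁ _) (𝒪-involutive c₁ Φ)
    𝒪-far (suc (suc zero)) (suc (suc zero)) _ Φ = trans (𝒪-involutive c₂ _) (𝒪-involutive c₂ Φ)
    𝒪-far zero             (suc zero)       (inj₁ (s≤s ()))     _
    𝒪-far (suc zero)       zero             (inj₂ (s≤s ()))     _
    𝒪-far (suc zero)       (suc (suc zero)) (inj₁ (s≤s (s≤s ()))) _
    𝒪-far (suc zero)       (suc (suc zero)) (inj₂ (s≤s ()))     _
    𝒪-far (suc (suc zero)) (suc zero)       (inj₁ (s≤s ()))     _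
    𝒪-far (suc (suc zero)) (suc zero)       (inj₂ (s≤s (s≤s ()))) _

  𝒪-premaniplex : IsPremaniplex P → IsPremaniplex (𝒪 P)
  𝒪-premaniplex (r-involutive , _ , connected) =
    𝒪-involutive r-involutive , 𝒪-far r-involutive , 𝒪-connected connected

  module _ (1≤m : 1 ≤ m) (noSemiEdge : ∀ i Ψ → r P i Ψ ≢ Ψ) where

    private
      r₂-moves-fst : ∀ Ψ k b Φ → (r P k Ψ , k , not b) ≡ Φ → proj₁ Φ ≢ Ψ
      r₂-moves-fst Ψ k b Φ refl = noSemiEdge k Ψ

    𝒪-noSemiEdge : ∀ i Φ → r (𝒪 P) i Φ ≢ Φ
    𝒪-noSemiEdge zero             (Ψ , y)     e = polyR0≢id y (cong proj₂ e)
    𝒪-noSemiEdge (suc zero)       (Ψ , y)     e = polyR1≢id y (cong proj₂ e)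
    𝒪-noSemiEdge (suc (suc zero)) (Ψ , k , b) e = noSemiEdge k Ψ (cong proj₁ e)

    𝒪-noParallelEdge : ∀ i j Φ → i ≢ j → r (𝒪 P) i Φ ≢ r (𝒪 P) j Φ
    𝒪-noParallelEdge zero             zero             _           i≢j _ = i≢j refl
    𝒪-noParallelEdge (suc zero)       (suc zero)       _           i≢j _ = i≢j refl
    𝒪-noParallelEdge (suc (suc zero)) (suc (suc zero)) _           i≢j _ = i≢j refl
    𝒪-noParallelEdge zero             (suc zero)       (Ψ , y)     _ e = polyR0≢polyR1 1≤m y (cong proj₂ e)
    𝒪-noParallelEdge (suc zero)       zero             (Ψ , y)     _ e = polyR0≢polyR1 1≤m y (sym (cong proj₂ e))
    𝒪-noParallelEdge zero             (suc (suc zero)) (Ψ , k , b) _ e = r₂-moves-fst Ψ k b _ (sym e) refl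
    𝒪-noParallelEdge (suc zero)       (suc (suc zero)) (Ψ , k , b) _ e = r₂-moves-fst Ψ k b _ (sym e) refl
    𝒪-noParallelEdge (suc (suc zero)) zero             (Ψ , k , b) _ e = r₂-moves-fst Ψ k b _ e refl
    𝒪-noParallelEdge (suc (suc zero)) (suc zero)       (Ψ , k , b) _ e = r₂-moves-fst Ψ k b _ e refl

  𝒪-maniplex : 1 ≤ m → IsManiplex P → IsManiplex (𝒪 P)
  𝒪-maniplex 1≤m (premaniplex , noSemiEdge , _) =
    𝒪-premaniplex premaniplex , 𝒪-noSemiEdge 1≤m noSemiEdge , 𝒪-noParallelEdge 1≤m noSemiEdge

-- Vertices of 𝒪 P and its intersection property

module Vertices {m : ℕ} (1≤m : 1 ≤ m) (P : FlagGraph (suc m)) (r-involutive : ∀ i Φ → r P i (r P i Φ) ≡ Φ)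
                (noSemiEdge : ∀ i Φ → r P i Φ ≢ Φ) (intersection : IntersectionProperty P)
                (simple : SimplePetriePolygons P) where
  open Cyclic {m}
  open Polygon {m}
  open Operation P
  open PetrieSuffix P r-involutive
  open PetriePolygons P
  open Walks P

  -- Walking around a vertex of 𝒪 P moves petrieVertex along a Petrie polygon of P, while the
  -- vertices of one facet sit at distinct positions of that polygon.
  petrieVertex : Flag (𝒪 P) → Flag P
  petrieVertex (Θ , y) = petrieFrom (suc (toℕ (polygonVertex y))) Θ

  petrieFrom-predMod : ∀ (i : Fin (suc m)) Θ →
    SamePetriePolygon (petrieFrom (suc (toℕ (predMod i))) Θ) (petrieFrom (toℕ i) Θ)
  petrieFrom-predMod zero    Θ =
    1 , 0 , cong (petrie P) (trans (cong (λ a → petrieFrom (suc a) Θ) (toℕ-predMod-zero zero refl)) (petrieFrom-all Θ))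
  petrieFrom-predMod (suc j) Θ =
    samePetrie-≡ (cong (λ a → petrieFrom (suc a) Θ) (toℕ-predMod-suc (suc j) refl))

  petrieVertex-step : ∀ (c : Fin 3) → c ≢ zero → ∀ Φ →
    SamePetriePolygon (petrieVertex Φ) (petrieVertex (r (𝒪 P) c Φ))
  petrieVertex-step zero             c≢0 _ = ⊥-elim (c≢0 refl)
  petrieVertex-step (suc zero)       _   (Θ , y) =
    samePetrie-≡ (cong (λ v → petrieFrom (suc (toℕ v)) Θ) (sym (polygonVertex-polyR1 y)))
  petrieVertex-step (suc (suc zero)) _   (Θ , i , false) =
    samePetrie-trans (petrieFrom-predMod i Θ) (samePetrie-≡ (petrieFrom-step i Θ))
  petrieVertex-step (suc (suc zero)) _   (Θ , i , true) =
    samePetrie-trans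
      (samePetrie-≡ (sym (trans (petrieFrom-step i (r P i Θ)) (cong (petrieFrom (suc (toℕ i))) (r-involutive i Θ)))))
      (samePetrie-sym (petrieFrom-predMod i (r P i Θ)))

  petrieVertex-walk : ∀ w → All (λ (c : Fin 3) → c ≢ zero) w → ∀ Φ →
                      SamePetriePolygon (petrieVertex Φ) (petrieVertex (walk (𝒪 P) w Φ))
  petrieVertex-walk []      []             Φ = samePetrie-≡ refl
  petrieVertex-walk (c ∷ w) (c≢0 ∷ w≢0) Φ =
    samePetrie-trans (petrieVertex-walk w w≢0 Φ) (petrieVertex-step c c≢0 (walk (𝒪 P) w Φ))

  petrieFrom-distinct : ∀ a b → 1 ≤ a → a < b → b ≤ suc m → ∀ Θ →
                        ¬ SamePetriePolygon (petrieFrom a Θ) (petrieFrom b Θ)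
  petrieFrom-distinct a b 1≤a a<b b≤n Θ same
    with petrieFrom-as-walk (suc m ∸ suc a) (suc a) (m∸n+n≡m (<-≤-trans a<b b≤n))
       | petrieFrom-as-walk (suc m ∸ b) b (m∸n+n≡m b≤n)
  ... | w , w>a , petrieFrom≡w | v , v≥b , petrieFrom≡v =
    higher-colours-cannot-undo P r-involutive intersection noSemiEdge i (reverse v ++ w)
      (++⁺ (all-reverse (All.map (<-≤-trans i<b) v≥b)) (All.map (≤-trans (s≤s (≤-reflexive (toℕ-fromℕ< a<n)))) w>a))
      Θ (begin
        walk P (reverse v ++ w) (r P i Θ)        ≡⟨ walk-++ (reverse v) w (r P i Θ) ⟩
        walk P (reverse v) (walk P w (r P i Θ))  ≡⟨ cong (walk P (reverse v)) (petrieFrom≡w (r P i Θ)) ⟨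
        walk P (reverse v) (petrieFrom (suc a) (r P i Θ)) ≡⟨ cong (walk P (reverse v)) (petrieFrom-suc a a<n Θ) ⟨
        walk P (reverse v) (petrieFrom a Θ)      ≡⟨ cong (walk P (reverse v)) (trans equal (petrieFrom≡v Θ)) ⟩
        walk P (reverse v) (walk P v Θ)          ≡⟨ walk-reverse-cancel r-involutive v Θ ⟩
        Θ                                        ∎)
    where
    open ≡-Reasoning
    a<n : a < suc m
    a<n = <-≤-trans a<b b≤n
    i : Fin (suc m)
    i = fromℕ< a<n
    i<b : toℕ i < b
    i<b = subst (_< b) (sym (toℕ-fromℕ< a<n)) a<b
    equal : petrieFrom a Θ ≡ petrieFrom b Θ
    equal = samePetrie-sameVertex r-involutive simple same
      (path-trans (path-sym r-involutive (petrieFrom-path a 1≤a (<⇒≤ a<n) Θ))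
                  (petrieFrom-path b (≤-trans 1≤a (<⇒≤ a<b)) b≤n Θ))

  petrieFrom-suc-injective : ∀ (i j : Fin (suc m)) Θ →
    SamePetriePolygon (petrieFrom (suc (toℕ i)) Θ) (petrieFrom (suc (toℕ j)) Θ) → i ≡ j
  petrieFrom-suc-injective i j Θ same with <-cmp (toℕ i) (toℕ j)
  ... | tri< i<j _ _ = ⊥-elim (petrieFrom-distinct _ _ (s≤s z≤n) (s≤s i<j) (toℕ<n j) Θ same)
  ... | tri≈ _ i≡j _ = toℕ-injective i≡j
  ... | tri> _ _ j<i = ⊥-elim (petrieFrom-distinct _ _ (s≤s z≤n) (s≤s j<i) (toℕ<n i) Θ (samePetrie-sym same))

  vertex∩facet : ∀ {Φ Ψ} → SameFacet (𝒪 P) Φ Ψ → SameVertex (𝒪 P) Φ Ψ → Ψ ≡ Φ ⊎ Ψ ≡ r (𝒪 P) c₁ Φ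
  vertex∩facet {Θ , y} {Θ′ , y′} facet vertex@(w , w≢0 , e) with sameFacet-fst facet
  ... | refl with polygonVertex-≡ y y′ (petrieFrom-suc-injective _ _ Θ
                    (subst (SamePetriePolygon (petrieVertex (Θ , y)) ∘ petrieVertex) e (petrieVertex-walk w w≢0 (Θ , y))))
  ...   | inj₁ y′≡y      = inj₁ (cong (Θ ,_) y′≡y)
  ...   | inj₂ y′≡polyR1 = inj₂ (cong (Θ ,_) y′≡polyR1)

module _ {m : ℕ} (1≤m : 1 ≤ m) (P : FlagGraph (suc m)) (r-involutive : ∀ i Φ → r P i (r P i Φ) ≡ Φ)
         (noSemiEdge : ∀ i Φ → r P i Φ ≢ Φ) (intersection : IntersectionProperty P)
         (simple : SimplePetriePolygons P) where
  open Operation P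
  open Walks (𝒪 P)
  open Vertices 1≤m P r-involutive noSemiEdge intersection simple using (vertex∩facet)

  private
    walk-single-colour : ∀ d w → All (_≡ d) w → ∀ Φ → walk (𝒪 P) w Φ ≡ Φ ⊎ walk (𝒪 P) w Φ ≡ r (𝒪 P) d Φ
    walk-single-colour d []      []            Φ = inj₁ refl
    walk-single-colour d (d ∷ w) (refl ∷ w≡d) Φ with walk-single-colour d w w≡d Φ
    ... | inj₁ walk≡Φ  = inj₂ (cong (r (𝒪 P) d) walk≡Φ)
    ... | inj₂ walk≡rd = inj₁ (trans (cong (r (𝒪 P) d) walk≡rd) (𝒪-involutive r-involutive d Φ))

    r₁-unreachable : ∀ d → d ≢ c₁ → ∀ Φ → ¬ PathIn (𝒪 P) (_≡ d) Φ (r (𝒪 P) c₁ Φ)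
    r₁-unreachable d d≢c₁ Φ (w , w≡d , e) with walk-single-colour d w w≡d Φ
    ... | inj₁ walk≡Φ  = 𝒪-noSemiEdge 1≤m noSemiEdge c₁ Φ (trans (sym e) walk≡Φ)
    ... | inj₂ walk≡rd = 𝒪-noParallelEdge 1≤m noSemiEdge c₁ d Φ (d≢c₁ ∘ sym) (trans (sym e) walk≡rd)

    meet : ∀ {m′ k Φ Ψ} → m′ ≤ 1 → 1 ≤ k →
           PathIn (𝒪 P) (InRange 0 m′) Φ Ψ → PathIn (𝒪 P) (InRange k 2) Φ Ψ → Ψ ≡ Φ ⊎ Ψ ≡ r (𝒪 P) c₁ Φ
    meet m′≤1 1≤k low high = vertex∩facet (path-map below-c₂ low) (path-map above-c₀ high)
      where
      below-c₂ : ∀ {c} → InRange 0 _ c → c ≢ c₂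
      below-c₂ (_ , 2≤m′) refl = 1+n≰n (≤-trans 2≤m′ m′≤1)
      above-c₀ : ∀ {c} → InRange _ 2 c → c ≢ zero
      above-c₀ (k≤0 , _) refl = 1+n≰n (≤-trans 1≤k k≤0)

    only-c₀ : ∀ {c} → InRange 0 0 c → c ≡ c₀
    only-c₀ {zero} _ = refl

    only-c₂ : ∀ {c} → InRange 2 2 c → c ≡ c₂
    only-c₂ {suc zero}       (s≤s () , _)
    only-c₂ {suc (suc zero)} _ = refl

  𝒪-intersection : IntersectionProperty (𝒪 P)
  𝒪-intersection zero                m′             _ _ low _ = low
  𝒪-intersection (suc (suc (suc k))) _              _ _ _ ([] , [] , e) = path-≡ e
  𝒪-intersection (suc (suc (suc k))) _              _ _ _ (_ ∷ _ , (3≤c , c≤2) ∷ _ , _) =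
    ⊥-elim (≤⇒≯ (≤-trans 3≤c c≤2) (s≤s (s≤s (s≤s z≤n))))
  𝒪-intersection (suc k)             (suc (suc m′)) _ _ _ high =
    path-map (λ (k≤c , c≤2) → k≤c , ≤-trans c≤2 (s≤s (s≤s z≤n))) high
  𝒪-intersection 1 1 Φ Ψ low high with meet ≤-refl ≤-refl low high
  ... | inj₁ Ψ≡Φ = path-≡ (sym Ψ≡Φ)
  ... | inj₂ refl = walk-path [ c₁ ] ((s≤s z≤n , s≤s z≤n) ∷ []) Φ
  𝒪-intersection 1 0 Φ Ψ low high with meet z≤n ≤-refl low high
  ... | inj₁ Ψ≡Φ = path-≡ (sym Ψ≡Φ)
  ... | inj₂ refl = ⊥-elim (r₁-unreachable c₀ (λ ()) Φ (path-map only-c₀ low))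
  𝒪-intersection 2 0 Φ Ψ low high with meet z≤n (s≤s z≤n) low high
  ... | inj₁ Ψ≡Φ = path-≡ (sym Ψ≡Φ)
  ... | inj₂ refl = ⊥-elim (r₁-unreachable c₂ (λ ()) Φ (path-map only-c₂ high))
  𝒪-intersection 2 1 Φ Ψ low high with meet ≤-refl (s≤s z≤n) low high
  ... | inj₁ Ψ≡Φ = path-≡ (sym Ψ≡Φ)
  ... | inj₂ refl = ⊥-elim (r₁-unreachable c₂ (λ ()) Φ (path-map only-c₂ high))

𝒪-polytope : ∀ {m} → 1 ≤ m → (P : FlagGraph (suc m)) → IsPolytope P → SimplePetriePolygons P → IsPolytope (𝒪 P)
𝒪-polytope 1≤m P (maniplex@((r-involutive , _) , noSemiEdge , _) , intersection) simple =
  Operation.𝒪-maniplex P 1≤m maniplex , 𝒪-intersection 1≤m P r-involutive noSemiEdge intersection simple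

-- Automorphisms of 𝒪 P

module 𝒪Automorphisms {m : ℕ} (P : FlagGraph (suc m)) where
  open Polygon {m}
  open Operation P
  open Automorphisms (𝒪 P)

  to-𝒪 : (β : Automorphism (𝒪 P)) → ∀ Ψ y →
         to β (Ψ , y) ≡ (proj₁ (to β (Ψ , base)) , walk 𝒴 (polygonWord y) (proj₂ (to β (Ψ , base))))
  to-𝒪 β Ψ y = begin
    to β (Ψ , y)                                   ≡⟨ cong (to β) (walk-polygonWord Ψ y) ⟨
    to β (walk (𝒪 P) (polygonWord y) (Ψ , base))   ≡⟨ walk-equivariant β (polygonWord y) (Ψ , base) ⟩
    walk (𝒪 P) (polygonWord y) (to β (Ψ , base))   ≡⟨ walk-𝒪-avoiding-c₂ _ (polygonWord-avoids-c₂ y) _ _ ⟩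
    (proj₁ (to β (Ψ , base)) , walk 𝒴 (polygonWord y) (proj₂ (to β (Ψ , base)))) ∎
    where open ≡-Reasoning

  lift : Automorphism P → Automorphism (𝒪 P)
  lift α = record
    { to = λ (Ψ , y) → to α Ψ , y
    ; from = λ (Ψ , y) → from α Ψ , y
    ; from∘to = λ (Ψ , y) → cong (_, y) (from∘to α Ψ)
    ; to∘from = λ (Ψ , y) → cong (_, y) (to∘from α Ψ)
    ; comm = lift-comm }
    where
    lift-comm : ∀ i Φ →
      (to α (proj₁ (r (𝒪 P) i Φ)) , proj₂ (r (𝒪 P) i Φ)) ≡ r (𝒪 P) i (to α (proj₁ Φ) , proj₂ Φ)
    lift-comm zero             _           = refl
    lift-comm (suc zero)       _           = refl
    lift-comm (suc (suc zero)) (Ψ , j , b) = cong (_, j , not b) (comm α j Ψ)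

  module Decomposition (connected : Connected P) (Φ₀ : Flag P) (β : Automorphism (𝒪 P)) where

    f : Flag P → Flag P
    f Ψ = proj₁ (to β (Ψ , base))

    D : Fin (suc m) × Bool
    D = proj₂ (to β (Φ₀ , base))

    δ : Fin (suc m) × Bool → Fin (suc m) × Bool
    δ y = walk 𝒴 (polygonWord y) D

    σ : Fin (suc m) → Fin (suc m)
    σ j = proj₁ (δ (j , false))

    private
      d : Flag P → Fin (suc m) × Bool
      d Ψ = proj₂ (to β (Ψ , base))

      r₂-image : ∀ j Ψ →
        (f (r P j Ψ) , walk 𝒴 (polygonWord (j , true)) (d (r P j Ψ)))
          ≡ (r P (proj₁ (walk 𝒴 (polygonWord (j , false)) (d Ψ))) (f Ψ) , walk 𝒴 (polygonWord (j , true)) (d Ψ))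
      r₂-image j Ψ = trans (sym (to-𝒪 β (r P j Ψ) (j , true)))
                           (trans (comm β c₂ (Ψ , j , false)) (cong (r (𝒪 P) c₂) (to-𝒪 β Ψ (j , false))))

      d-r : ∀ j Ψ → d (r P j Ψ) ≡ d Ψ
      d-r j Ψ = Walks.walk-injective 𝒴 𝒴-involutive (polygonWord (j , true)) (cong proj₂ (r₂-image j Ψ))

      d-walk : ∀ w Ψ → d (walk P w Ψ) ≡ d Ψ
      d-walk []      Ψ = refl
      d-walk (c ∷ w) Ψ = trans (d-r c (walk P w Ψ)) (d-walk w Ψ)

      d-constant : ∀ Ψ → d Ψ ≡ D
      d-constant Ψ with connected Φ₀ Ψ
      ... | w , _ , refl = d-walk w Φ₀

    to-β : ∀ Ψ y → to β (Ψ , y) ≡ (f Ψ , δ y)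
    to-β Ψ y = trans (to-𝒪 β Ψ y) (cong (λ x → f Ψ , walk 𝒴 (polygonWord y) x) (d-constant Ψ))

    δ-polyR0 : ∀ y → δ (polyR0 y) ≡ polyR0 (δ y)
    δ-polyR0 y = cong proj₂
      (trans (sym (to-β Φ₀ (polyR0 y))) (trans (comm β c₀ (Φ₀ , y)) (cong (r (𝒪 P) c₀) (to-β Φ₀ y))))

    δ-polyR1 : ∀ y → δ (polyR1 y) ≡ polyR1 (δ y)
    δ-polyR1 y = cong proj₂
      (trans (sym (to-β Φ₀ (polyR1 y))) (trans (comm β c₁ (Φ₀ , y)) (cong (r (𝒪 P) c₁) (to-β Φ₀ y))))

    f-r : ∀ j Ψ → f (r P j Ψ) ≡ r P (σ j) (f Ψ)
    f-r j Ψ = trans (cong proj₁ (r₂-image j Ψ))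
                    (cong (λ x → r P (proj₁ (walk 𝒴 (polygonWord (j , false)) x)) (f Ψ)) (d-constant Ψ))

    f-recolouring : Recolouring P σ
    f-recolouring = record
      { to = f ; from = f⁻¹
      ; from∘to = λ Ψ → trans (sym (cong proj₁ (to-𝒪 (β ⁻¹ᴬ) (f Ψ) (d Ψ))))
                              (cong proj₁ (from∘to β (Ψ , base)))
      ; to∘from = λ Θ → trans (sym (cong proj₁ (to-𝒪 β (f⁻¹ Θ) (proj₂ (from β (Θ , base))))))
                              (cong proj₁ (to∘from β (Θ , base)))
      ; comm = f-r }
      where
      f⁻¹ : Flag P → Flag P
      f⁻¹ Θ = proj₁ (from β (Θ , base))

module _ {m : ℕ} (2≤m : 2 ≤ m) (P : FlagGraph (suc m)) (premaniplex : IsPremaniplex P)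
         (intersection : IntersectionProperty P) (chiral : IsChiral P) (notSelfDual : ¬ SelfDual P) where
  open Cyclic {m}
  open Polygon {m}
  open 𝒪Automorphisms P

  private
    r-involutive : ∀ i Φ → r P i (r P i Φ) ≡ Φ
    r-involutive = proj₁ premaniplex
    far-commute : ∀ i j → Far i j → ∀ Φ → r P i (r P j (r P i (r P j Φ))) ≡ Φ
    far-commute = proj₁ (proj₂ premaniplex)
    connected : Connected P
    connected = proj₂ (proj₂ premaniplex)

    r₀-rₘ-commute : ∀ X → r P zero (r P last X) ≡ r P last (r P zero X)
    r₀-rₘ-commute = commute-of-involutions (r P zero) (r P last) (r-involutive zero) (r-involutive last)
                      (far-commute zero last (inj₁ (subst (2 ≤_) (sym (toℕ-fromℕ m)) 2≤m)))

  -- σ is a rotation or a reflection of the cycle of colours; all of them except the identity and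
  -- j ↦ n-1-j send the commuting pair (0 , n-1) to a pair of adjacent colours.
  𝒪-automorphism-is-lift : (β : Automorphism (𝒪 P)) →
                           Σ (Automorphism P) λ α → ∀ Ψ y → to β (Ψ , y) ≡ (to α Ψ , y)
  𝒪-automorphism-is-lift β = classify (proj₁ D) (proj₂ D) refl
    where
    open Decomposition connected (proj₁ (proj₁ chiral)) β

    σ-last : σ last ≡ proj₁ (polyR0 (polyR1 D))
    σ-last = cong proj₁ (begin
      δ (last , false)                ≡⟨ cong (λ i → δ (i , false)) predMod-zero ⟨
      δ (polyR0 (polyR1 base))        ≡⟨ δ-polyR0 (polyR1 base) ⟩
      polyR0 (δ (polyR1 base))        ≡⟨ cong polyR0 (δ-polyR1 base) ⟩
      polyR0 (polyR1 D)               ∎)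
      where open ≡-Reasoning

    commuting-pair : ∀ {a b} → σ zero ≡ a → σ last ≡ b → ∀ X → r P a (r P b X) ≡ r P b (r P a X)
    commuting-pair refl refl = recolouring-commute f-recolouring zero last r₀-rₘ-commute

    noncommuting : ∀ a b → toℕ b ≡ suc (toℕ a) → ¬ (∀ X → r P a (r P b X) ≡ r P b (r P a X))
    noncommuting = adjacent-reflections-noncommuting P premaniplex intersection chiral

    classify : ∀ c b → D ≡ (c , b) → Σ (Automorphism P) λ α → ∀ Ψ y → to β (Ψ , y) ≡ (to α Ψ , y)
    classify zero    false D≡base =
      recolouring-automorphism f-recolouring (λ j → cong proj₁ (δ≡id (j , false))) ,
      λ Ψ y → trans (to-β Ψ y) (cong (f Ψ ,_) (δ≡id y))
      where
      δ≡id : ∀ y → δ y ≡ y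
      δ≡id y = trans (cong (walk 𝒴 (polygonWord y)) D≡base) (polygonWord-from-base y)
    classify (suc c) false D≡c =
      ⊥-elim (noncommuting (predMod (suc c)) (suc c) (cong suc (sym (toℕ-predMod-suc (suc c) refl)))
                (λ X → sym (commuting-pair (cong proj₁ D≡c) (trans σ-last (cong (proj₁ ∘ polyR0 ∘ polyR1) D≡c)) X)))
    classify c true D≡c with m≤n⇒m<n∨m≡n (≤-pred (toℕ<n c))
    ... | inj₁ c<m = ⊥-elim (noncommuting c (sucMod c) (toℕ-sucMod-< c c<m)
                       (commuting-pair (cong proj₁ D≡c) (trans σ-last (cong (proj₁ ∘ polyR0 ∘ polyR1) D≡c))))
    ... | inj₂ c≡m = ⊥-elim (notSelfDual (recolouring-duality f-recolouring σ≡opposite))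
      where
      D≡last : D ≡ (last , true)
      D≡last = trans D≡c (cong (_, true) (toℕ-injective (trans c≡m (sym (toℕ-fromℕ m)))))
      σ≡opposite : ∀ j → σ j ≡ opposite j
      σ≡opposite j = cong proj₁ (trans (cong (walk 𝒴 (polygonWord (j , false))) D≡last) (polygonWord-from-last j))

-- Odd chiral polytopes

module OddChiral {k : ℕ} (1≤k : 1 ≤ k) (P : FlagGraph (suc (2 * k))) (polytope : IsPolytope P)
            (chiral : IsChiral P) (notSelfDual : ¬ SelfDual P) (simple : SimplePetriePolygons P) where
  open Cyclic {2 * k}
  open Polygon {2 * k}
  open Operation P
  open Walks (𝒪 P)
  open Automorphisms
  open Chirality P chiral
  open 𝒪Automorphisms P using (lift)

  private
    premaniplex : IsPremaniplex P
    premaniplex = proj₁ (proj₁ polytope)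
    r-involutive : ∀ i Φ → r P i (r P i Φ) ≡ Φ
    r-involutive = proj₁ premaniplex
    connected : Connected P
    connected = proj₂ (proj₂ premaniplex)
    intersection : IntersectionProperty P
    intersection = proj₂ polytope

    2≤m : 2 ≤ 2 * k
    2≤m = *-monoʳ-≤ 2 1≤k

    unlift : (β : Automorphism (𝒪 P)) → Σ (Automorphism P) λ α → ∀ Ψ y → to β (Ψ , y) ≡ (to α Ψ , y)
    unlift = 𝒪-automorphism-is-lift 2≤m P premaniplex intersection chiral notSelfDual

  sameOrbit-𝒪⇒ : ∀ {Θ y Θ′ y′} → SameOrbit (𝒪 P) (Θ , y) (Θ′ , y′) → SameOrbit P Θ Θ′ × y ≡ y′
  sameOrbit-𝒪⇒ {Θ} {y} {Θ′} {y′} (β , β[Θ,y]≡) with unlift β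
  ... | α , β≡liftα = (α , cong proj₁ liftα[Θ,y]≡) , cong proj₂ liftα[Θ,y]≡
    where
    liftα[Θ,y]≡ : (to α Θ , y) ≡ (Θ′ , y′)
    liftα[Θ,y]≡ = trans (sym (β≡liftα Θ y)) β[Θ,y]≡

  sameOrbit⇒sameOrbit-𝒪 : ∀ {Θ Θ′} y → SameOrbit P Θ Θ′ → SameOrbit (𝒪 P) (Θ , y) (Θ′ , y)
  sameOrbit⇒sameOrbit-𝒪 y (α , refl) = lift α , refl

  sameFacetOrbit⇒sameOrbit : ∀ {Θ y Θ′ y′} → SameFacetOrbit (𝒪 P) (Θ , y) (Θ′ , y′) → SameOrbit P Θ Θ′
  sameFacetOrbit⇒sameOrbit {Θ} {y} (β , facet) with unlift β
  ... | α , β≡liftα = α , trans (cong proj₁ (sym (β≡liftα Θ y))) (sameFacet-fst facet)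

  sameOrbit⇒sameFacetOrbit : ∀ {Θ Θ′} y y′ → SameOrbit P Θ Θ′ → SameFacetOrbit (𝒪 P) (Θ , y) (Θ′ , y′)
  sameOrbit⇒sameFacetOrbit {Θ} y y′ (α , refl) = lift α , sameFacet-intro (to α Θ) y y′

  vertex-descent : ∀ t (i : Fin (suc (2 * k))) Θ → toℕ i ≡ t →
                   Σ (Flag P) λ X → SameVertex (𝒪 P) (Θ , i , false) (X , base) × orbit X ≡ iterate not (orbit Θ) t
  vertex-descent zero    i Θ i≡0 = Θ , path-≡ (cong (λ j → Θ , j , false) (toℕ-injective i≡0)) , refl
  vertex-descent (suc t) i Θ i≡1+t with vertex-descent t (predMod i) (r P (predMod i) Θ) (toℕ-predMod-suc i i≡1+t)
  ... | X , path , orbitX = X , path-trans (walk-path (c₂ ∷ c₁ ∷ []) ((λ ()) ∷ (λ ()) ∷ []) _) path ,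
                            trans orbitX (cong (λ s → iterate not s t) (orbit-r (predMod i) Θ))

  -- Going once around a vertex applies all n reflections of P, and n is odd.
  base-flags-of-both-orbits : ∀ X s → Σ (Flag P) λ Y → SameVertex (𝒪 P) (X , base) (Y , base) × orbit Y ≡ s
  base-flags-of-both-orbits X s with orbit X ≟ s
  ... | yes orbitX≡s = X , path-refl , orbitX≡s
  ... | no  orbitX≢s with vertex-descent (2 * k) (predMod zero) (r P (predMod zero) X) (toℕ-predMod-zero zero refl)
  ...   | Y , path , orbitY = Y , path-trans (walk-path (c₂ ∷ c₁ ∷ []) ((λ ()) ∷ (λ ()) ∷ []) _) path , (begin
    orbit Y                                           ≡⟨ orbitY ⟩
    iterate not (orbit (r P (predMod zero) X)) (2 * k) ≡⟨ cong (λ b → iterate not b (2 * k)) (orbit-r (predMod zero) X) ⟩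
    iterate not (not (orbit X)) (2 * k)               ≡⟨ iterate-not-even k (not (orbit X)) ⟩
    not (orbit X)                                     ≡⟨ ≢⇒≡not (orbitX≢s ∘ sym) ⟨
    s                                                 ∎)
    where open ≡-Reasoning

  vertex-meets-every-orbit : ∀ Φ s → Σ (Flag P) λ Y → SameVertex (𝒪 P) Φ (Y , base) × orbit Y ≡ s
  vertex-meets-every-orbit (Θ , i , false) s with vertex-descent (toℕ i) i Θ refl
  ... | X , path , _ with base-flags-of-both-orbits X s
  ...   | Y , path′ , orbitY = Y , path-trans path path′ , orbitY
  vertex-meets-every-orbit (Θ , i , true)  s with vertex-descent (toℕ i) i (r P i Θ) refl
  ... | X , path , _ with base-flags-of-both-orbits X s
  ...   | Y , path′ , orbitY = Y , path-trans (walk-path (c₂ ∷ []) ((λ ()) ∷ []) _) (path-trans path path′) , orbitY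

  𝒪-vertex-transitive : ∀ Φ Ψ → Σ (Automorphism (𝒪 P)) λ β → SameVertex (𝒪 P) (to β Φ) Ψ
  𝒪-vertex-transitive Φ Ψ with vertex-meets-every-orbit Φ true | vertex-meets-every-orbit Ψ true
  ... | X , Φ∼X , orbitX | X′ , Ψ∼X′ , orbitX′ with orbit≡⇒sameOrbit (trans orbitX (sym orbitX′))
  ...   | α , αX≡X′ = lift α ,
    path-trans (path-equivariant (𝒪 P) (lift α) Φ∼X)
      (path-trans (path-≡ (cong (_, base) αX≡X′)) (path-sym (𝒪-involutive r-involutive) Ψ∼X′))

  𝒪-two-facet-orbits : Σ (Flag (𝒪 P)) λ Φ₀ → Σ (Flag (𝒪 P)) λ Φ₁ →
    ¬ SameFacetOrbit (𝒪 P) Φ₀ Φ₁ × (∀ Ψ → SameFacetOrbit (𝒪 P) Φ₀ Ψ ⊎ SameFacetOrbit (𝒪 P) Φ₁ Ψ)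
  𝒪-two-facet-orbits = (Ψ₀ , base) , (Ψ₁ , base) , apart , covering
    where
    Ψ₀ Ψ₁ : Flag P
    Ψ₀ = proj₁ (orbit-surjective true)
    Ψ₁ = proj₁ (orbit-surjective false)
    apart : ¬ SameFacetOrbit (𝒪 P) (Ψ₀ , base) (Ψ₁ , base)
    apart Ψ₀∼Ψ₁ with trans (sym (proj₂ (orbit-surjective true)))
                           (trans (sameOrbit⇒orbit≡ (sameFacetOrbit⇒sameOrbit Ψ₀∼Ψ₁)) (proj₂ (orbit-surjective false)))
    ... | ()
    covering : ∀ Ψ → SameFacetOrbit (𝒪 P) (Ψ₀ , base) Ψ ⊎ SameFacetOrbit (𝒪 P) (Ψ₁ , base) Ψ
    covering (Θ , y) with orbit Θ in orbitΘ
    ... | true  = inj₁ (sameOrbit⇒sameFacetOrbit base y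
                          (orbit≡⇒sameOrbit (trans (proj₂ (orbit-surjective true)) (sym orbitΘ))))
    ... | false = inj₂ (sameOrbit⇒sameFacetOrbit base y
                          (orbit≡⇒sameOrbit (trans (proj₂ (orbit-surjective false)) (sym orbitΘ))))

  𝒪-r₂-changes-facet-orbit : ∀ Φ → ¬ SameFacetOrbit (𝒪 P) Φ (r (𝒪 P) c₂ Φ)
  𝒪-r₂-changes-facet-orbit (Θ , i , b) Φ∼r₂Φ =
    not-¬ refl (trans (sameOrbit⇒orbit≡ (sameFacetOrbit⇒sameOrbit Φ∼r₂Φ)) (orbit-r i Θ))

  𝒪-alternating-semiregular : IsAlternatingSemiregular (𝒪 P)
  𝒪-alternating-semiregular =
    (𝒪-polytope (≤-trans (s≤s z≤n) 2≤m) P polytope simple , 𝒪-vertex-transitive) ,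
    𝒪-two-facet-orbits , 𝒪-r₂-changes-facet-orbit

  𝒪-trivial-facet-stabilizer : TrivialFacetStabilizer (𝒪 P)
  𝒪-trivial-facet-stabilizer β (Θ , y) facet (Θ′ , y′) with unlift β
  ... | α , β≡liftα = trans (β≡liftα Θ′ y′) (cong (_, y′) (fixing-a-flag⇒identity P connected α Θ αΘ≡Θ Θ′))
    where
    αΘ≡Θ : to α Θ ≡ Θ
    αΘ≡Θ = trans (cong proj₁ (sym (β≡liftα Θ y))) (sameFacet-fst facet)

  𝒪-symmetry-type-graph : SymmetryTypeGraphIso (𝒪 P) (𝒜 (suc (2 * k)))
  𝒪-symmetry-type-graph = φ , (λ Φ Ψ → mk⇔ (φ≡⇒sameOrbit Φ Ψ) (sameOrbit⇒φ≡ Φ Ψ)) , φ-surjective , φ-comm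
    where
    φ : Flag (𝒪 P) → Flag (𝒜 (suc (2 * k)))
    φ (Θ , y) = orbit Θ , y

    φ≡⇒sameOrbit : ∀ Φ Ψ → φ Φ ≡ φ Ψ → SameOrbit (𝒪 P) Φ Ψ
    φ≡⇒sameOrbit (Θ , y) (Θ′ , y′) e with cong proj₂ e
    ... | refl = sameOrbit⇒sameOrbit-𝒪 y (orbit≡⇒sameOrbit (cong proj₁ e))

    sameOrbit⇒φ≡ : ∀ Φ Ψ → SameOrbit (𝒪 P) Φ Ψ → φ Φ ≡ φ Ψ
    sameOrbit⇒φ≡ (Θ , y) (Θ′ , y′) Φ∼Ψ with sameOrbit-𝒪⇒ Φ∼Ψ
    ... | Θ∼Θ′ , refl = cong (_, y) (sameOrbit⇒orbit≡ Θ∼Θ′)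

    φ-surjective : ∀ x → Σ (Flag (𝒪 P)) λ Φ → φ Φ ≡ x
    φ-surjective (s , y) = (proj₁ (orbit-surjective s) , y) , cong (_, y) (proj₂ (orbit-surjective s))

    φ-comm : ∀ i Φ → φ (r (𝒪 P) i Φ) ≡ r (𝒜 (suc (2 * k))) i (φ Φ)
    φ-comm zero             _           = refl
    φ-comm (suc zero)       _           = refl
    φ-comm (suc (suc zero)) (Θ , j , b) = cong (_, j , not b) (orbit-r j Θ)

theorem9p3 : (n : ℕ) → Odd n → (P : FlagGraph n) →
    IsPolytope P → IsChiral P → ¬ SelfDual P → SimplePetriePolygons P →
    IsAlternatingSemiregular (𝒪 P)
      × TrivialFacetStabilizer (𝒪 P)
      × SymmetryTypeGraphIso (𝒪 P) (𝒜 n)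
theorem9p3 .1 (zero , refl) P polytope chiral _ _ =
  ⊥-elim (rank-one-not-chiral P (proj₁ (proj₁ (proj₁ polytope))) chiral)
theorem9p3 .(suc (2 * suc k)) (suc k , refl) P polytope chiral notSelfDual simple =
  𝒪-alternating-semiregular , 𝒪-trivial-facet-stabilizer , 𝒪-symmetry-type-graph
  where open OddChiral (s≤s z≤n) P polytope chiral notSelfDual simple
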